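{- For every integer $n\geq 3$, the number of Fishburn permutations of length $n$ that avoid both classical patterns $321$ and $1324$ equals $\frac{3}{2}n^{2}-\frac{13}{2}n+10$.
   Context: A permutation of length $n$ is a rearrangement $\pi=\pi_1\cdots\pi_n$ of $[n]$. A permutation $\pi$ contains a classical pattern $p\in S_k$ if some subsequence of $\pi$ of length $k$ is order-isomorphic to $p$; otherwise it avoids $p$. A Fishburn permutation is a permutation $\pi$ for which there are no indices $i<j$ with $\pi_j<\pi_i<\pi_{i+1}$ and $\pi_i=\pi_j+1$. -}

module Defs where

open import Data.Nat using (ℕ; _<_; _+_; _*_)
open import Data.Fin using (Fin; toℕ; suc) renaming (_<_ to _<ᶠ_)
open import Data.Vec using (Vec; lookup)
open import Data.Product using (Σ; ∃; _×_; _,_)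
open import Data.List using (List; length)
open import Data.List.Membership.Propositional using (_∈_)
open import Data.List.Relation.Unary.Unique.Propositional using (Unique)
open import Relation.Binary.PropositionalEquality using (_≡_)
open import Relation.Nullary using (¬_)
open import Function.Bundles using (_⇔_)

Word : ℕ → Set
Word n = Vec (Fin n) n

-- A permutation of length n: a word in which every value occurs at distinct positions
-- (injective, hence bijective on Fin n).
IsPerm : ∀ {n} → Word n → Set
IsPerm {n} π = ∀ (i j : Fin n) → lookup π i ≡ lookup π j → i ≡ j

_<at_ : ∀ {n} → Fin n → Fin n → Set
a <at b = toℕ a < toℕ b

Contains321 : ∀ {n} → Word n → Set
Contains321 {n} π = Σ (Fin n) λ i → Σ (Fin n) λ j → Σ (Fin n) λ k →
  (i <ᶠ j) × (j <ᶠ k) × (lookup π j <at lookup π i) × (lookup π k <at lookup π j)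

Contains1324 : ∀ {n} → Word n → Set
Contains1324 {n} π = Σ (Fin n) λ i → Σ (Fin n) λ j → Σ (Fin n) λ k → Σ (Fin n) λ l →
  (i <ᶠ j) × (j <ᶠ k) × (k <ᶠ l) ×
  (lookup π i <at lookup π k) × (lookup π k <at lookup π j) × (lookup π j <at lookup π l)

IsFishburn : ∀ {n} → Word n → Set
IsFishburn {n} π = ¬ (Σ (Fin n) λ i → Σ (Fin n) λ j → Σ (Fin n) λ i+1 →
  (toℕ i+1 ≡ 1 + toℕ i) × (i <ᶠ j) ×
  (lookup π j <at lookup π i) × (lookup π i <at lookup π i+1) ×
  (toℕ (lookup π i) ≡ 1 + toℕ (lookup π j)))

FishburnAvoiding321-1324 : ∀ {n} → Word n → Set
FishburnAvoiding321-1324 π = IsPerm π × IsFishburn π × ¬ Contains321 π × ¬ Contains1324 π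

NumberOf : (n : ℕ) → (Word n → Set) → ℕ → Set
NumberOf n P c = Σ (List (Word n)) λ L →
  Unique L × (∀ π → (π ∈ L) ⇔ P π) × (length L ≡ c)

-- Let n = top + 1 and k = π 0. Such a permutation continues with the remaining values in
-- increasing order for as long as it can. Avoiding 321 and 1324 and the Fishburn condition
-- leave only two ways to deviate from this, and each forces the rest of the permutation:
-- jump to top (after which the rest stays increasing), which gives for each k < top one
-- permutation per position of top, top − 1 of them if k > 0 and top if k = 0; or, when
-- 1 ≤ j < k ≤ top − 2, jump from 0, …, j − 1 to the block k + 1, …, top followed by
-- j, …, k − 1, which gives k − 1 permutations for each such k. Adding the permutation
-- top, 0, 1, …, top − 1, the count is top + (top − 1)² + 1 + (top − 3)(top − 2)/2.

module Submission where

open import Defs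
open import Data.Nat
  using (ℕ; zero; suc; pred; _≤_; _<_; _+_; _*_; _∸_; z≤n; s≤s; s≤s⁻¹; s<s⁻¹; z<s; s<s; _<?_; _≤?_; _≟_; >-nonZero)
open import Data.Nat.Properties
open import Data.Nat.Tactic.RingSolver using (solve-∀)
open import Data.Fin as Fin using (Fin; toℕ; fromℕ<; punchOut)
open import Data.Fin.Properties using (toℕ-fromℕ<; toℕ-injective; toℕ<n; punchOut-injective; injective⇒≤; any?)
open import Data.Vec using (Vec; []; _∷_; lookup; tabulate)
open import Data.Vec.Properties using (lookup∘tabulate; tabulate∘lookup; tabulate-cong)
open import Data.Product using (Σ; ∃; _×_; _,_; proj₁; proj₂)
open import Data.Sum using (_⊎_; inj₁; inj₂; [_,_]′)
open import Data.Empty using (⊥; ⊥-elim)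
open import Data.List using (List; []; _∷_; _++_; map; concatMap; applyDownFrom; length)
open import Data.List.Properties using (length-++; length-map; length-applyDownFrom)
open import Data.List.Membership.Propositional using (_∈_; find; lose)
open import Data.List.Membership.Propositional.Properties
  using (∈-map⁺; ∈-map⁻; ∈-++⁺ˡ; ∈-++⁺ʳ; ∈-++⁻; ∈-concatMap⁺; ∈-concatMap⁻; ∈-applyDownFrom⁺; ∈-applyDownFrom⁻)
open import Data.List.Relation.Unary.Any using (here; there)
import Data.List.Relation.Unary.All as All
import Data.List.Relation.Unary.All.Properties as All
open import Data.List.Relation.Unary.AllPairs using ([]; _∷_)
open import Data.List.Relation.Unary.Unique.Propositional using (Unique)
import Data.List.Relation.Unary.Unique.Propositional.Properties as Unique
open import Function using (_∘_; _⇔_; mk⇔; Equivalence)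
open import Function.Definitions using (Injective)
open import Relation.Binary using (tri<; tri≈; tri>)
open import Relation.Binary.PropositionalEquality
open import Relation.Nullary using (¬_; yes; no; contradiction)

-- Permutations as functions on positions

Bounded : ℕ → (ℕ → ℕ) → Set
Bounded n f = ∀ {i} → i < n → f i < n

InjectiveBelow : ℕ → (ℕ → ℕ) → Set
InjectiveBelow n f = ∀ {i j} → i < n → j < n → f i ≡ f j → i ≡ j

AgreeBelow : ℕ → (ℕ → ℕ) → (ℕ → ℕ) → Set
AgreeBelow P f g = ∀ {p} → p < P → f p ≡ g p

extend : ∀ {P f g} → AgreeBelow P f g → f P ≡ g P → AgreeBelow (suc P) f g
extend agree fP≡gP p<P+1 with m≤n⇒m<n∨m≡n (s≤s⁻¹ p<P+1)
... | inj₁ p<P   = agree p<P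
... | inj₂ refl = fP≡gP

record FishburnAvoider (n : ℕ) (f : ℕ → ℕ) : Set where
  field
    bounded    : Bounded n f
    injective  : InjectiveBelow n f
    avoids321  : ∀ {a b c} → a < b → b < c → c < n → f b < f a → f c < f b → ⊥
    avoids1324 : ∀ {a b c d} → a < b → b < c → c < d → d < n →
                 f a < f c → f c < f b → f b < f d → ⊥
    fishburn   : ∀ {i j} → i < j → j < n → suc i < n → f i < f (suc i) → f i ≡ suc (f j) → ⊥

injective⇒surjective : ∀ {n} {F : Fin n → Fin n} → Injective _≡_ _≡_ F → ∀ w → ∃ λ i → F i ≡ w
injective⇒surjective {suc n} {F} F-injective w with any? (λ i → F i Fin.≟ w)
... | yes hit = hit
... | no miss = contradiction (injective⇒≤ punched-injective) 1+n≰n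
  where
  punched : Fin (suc n) → Fin n
  punched i = punchOut {i = w} {j = F i} (λ e → miss (i , sym e))
  punched-injective : Injective _≡_ _≡_ punched
  punched-injective {i} {j} eq =
    F-injective (punchOut-injective (λ e → miss (i , sym e)) (λ e → miss (j , sym e)) eq)

bounded-injective⇒surjective : ∀ {n f} → Bounded n f → InjectiveBelow n f →
                               ∀ {v} → v < n → ∃ λ i → i < n × f i ≡ v
bounded-injective⇒surjective {n} {f} bounded injective {v} v<n =
  let i , Fi≡w = injective⇒surjective F-injective (fromℕ< v<n)
  in toℕ i , toℕ<n i , trans (sym (toℕ-fromℕ< _)) (trans (cong toℕ Fi≡w) (toℕ-fromℕ< v<n))
  where
  F : Fin n → Fin n
  F i = fromℕ< (bounded (toℕ<n i))
  F-injective : Injective _≡_ _≡_ F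
  F-injective {i} {j} eq = toℕ-injective (injective (toℕ<n i) (toℕ<n j)
    (trans (sym (toℕ-fromℕ< _)) (trans (cong toℕ eq) (toℕ-fromℕ< _))))

injectiveBelow : ∀ {n f} → (∀ {a b} → a < b → b < n → f a ≢ f b) → InjectiveBelow n f
injectiveBelow {n} distinct {i} {j} i<n j<n eq with <-cmp i j
... | tri< i<j _ _ = contradiction eq (distinct i<j j<n)
... | tri≈ _ i≡j _ = i≡j
... | tri> _ _ j<i = contradiction (sym eq) (distinct j<i i<n)

at : ∀ {m n} → Vec (Fin n) m → ℕ → ℕ
at []       _       = 0
at (x ∷ _)  zero    = toℕ x
at (_ ∷ xs) (suc i) = at xs i

at-lookup : ∀ {m n} (π : Vec (Fin n) m) (i : Fin m) → at π (toℕ i) ≡ toℕ (lookup π i)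
at-lookup (_ ∷ _) Fin.zero    = refl
at-lookup (_ ∷ π) (Fin.suc i) = at-lookup π i

at-fromℕ< : ∀ {m n} (π : Vec (Fin n) m) {i} (i<m : i < m) → at π i ≡ toℕ (lookup π (fromℕ< i<m))
at-fromℕ< π i<m = trans (cong (at π) (sym (toℕ-fromℕ< i<m))) (at-lookup π (fromℕ< i<m))

word⇒avoider : ∀ {n} {π : Word n} → FishburnAvoiding321-1324 π → FishburnAvoider n (at π)
word⇒avoider {n} {π} (perm , fishburn , ¬321 , ¬1324) = record
  { bounded    = λ i<n → subst (_< n) (sym (at-fromℕ< π i<n)) (toℕ<n _)
  ; injective  = λ i<n j<n eq → trans (sym (toℕ-fromℕ< i<n))
      (trans (cong toℕ (perm _ _ (toℕ-injective
        (trans (sym (at-fromℕ< π i<n)) (trans eq (at-fromℕ< π j<n)))))) (toℕ-fromℕ< j<n))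
  ; avoids321  = λ a<b b<c c<n fb<fa fc<fb →
      let b<n = <-trans b<c c<n ; a<n = <-trans a<b b<n in
      ¬321 (fromℕ< a<n , fromℕ< b<n , fromℕ< c<n , pos-< a<n b<n a<b , pos-< b<n c<n b<c ,
            value-< b<n a<n fb<fa , value-< c<n b<n fc<fb)
  ; avoids1324 = λ a<b b<c c<d d<n fa<fc fc<fb fb<fd →
      let c<n = <-trans c<d d<n ; b<n = <-trans b<c c<n ; a<n = <-trans a<b b<n in
      ¬1324 (fromℕ< a<n , fromℕ< b<n , fromℕ< c<n , fromℕ< d<n ,
             pos-< a<n b<n a<b , pos-< b<n c<n b<c , pos-< c<n d<n c<d ,
             value-< a<n c<n fa<fc , value-< c<n b<n fc<fb , value-< b<n d<n fb<fd)
  ; fishburn   = λ {i} {j} i<j j<n i+1<n fi<fi+1 fi≡fj+1 →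
      let i<n = <-trans i<j j<n in
      fishburn (fromℕ< i<n , fromℕ< j<n , fromℕ< i+1<n ,
                trans (toℕ-fromℕ< i+1<n) (cong suc (sym (toℕ-fromℕ< i<n))) , pos-< i<n j<n i<j ,
                value-< j<n i<n (subst (at π j <_) (sym fi≡fj+1) (n<1+n _)) ,
                value-< i<n i+1<n fi<fi+1 ,
                trans (sym (at-fromℕ< π i<n)) (trans fi≡fj+1 (cong suc (at-fromℕ< π j<n))))
  }
  where
  pos-< : ∀ {a b} (a<n : a < n) (b<n : b < n) → a < b → fromℕ< a<n Fin.< fromℕ< b<n
  pos-< a<n b<n = subst₂ _<_ (sym (toℕ-fromℕ< a<n)) (sym (toℕ-fromℕ< b<n))
  value-< : ∀ {a b} (a<n : a < n) (b<n : b < n) → at π a < at π b →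
            lookup π (fromℕ< a<n) <at lookup π (fromℕ< b<n)
  value-< a<n b<n = subst₂ _<_ (at-fromℕ< π a<n) (at-fromℕ< π b<n)

-- A junk value when v ≥ n: wordOf is only ever applied to functions bounded on [0, n).
clamp : ∀ {n} → Fin n → ℕ → Fin n
clamp {n} i v with v <? n
... | yes v<n = fromℕ< v<n
... | no _    = i

toℕ-clamp : ∀ {n} (i : Fin n) {v} → v < n → toℕ (clamp i v) ≡ v
toℕ-clamp {n} i {v} v<n with v <? n
... | yes _   = toℕ-fromℕ< _
... | no v≮n = contradiction v<n v≮n

wordOf : ∀ {n} → (ℕ → ℕ) → Word n
wordOf g = tabulate λ i → clamp i (g (toℕ i))

toℕ-lookup-wordOf : ∀ {n} g (i : Fin n) → g (toℕ i) < n → toℕ (lookup (wordOf g) i) ≡ g (toℕ i)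
toℕ-lookup-wordOf g i gi<n = trans (cong toℕ (lookup∘tabulate _ i)) (toℕ-clamp i gi<n)

at-wordOf : ∀ {n g p} → Bounded n g → p < n → at (wordOf {n} g) p ≡ g p
at-wordOf {n} {g} bounded p<n =
  trans (at-fromℕ< (wordOf g) p<n)
        (trans (toℕ-lookup-wordOf g (fromℕ< p<n) (bounded (toℕ<n _))) (cong g (toℕ-fromℕ< p<n)))

avoider⇒word : ∀ {n g} → FishburnAvoider n g → FishburnAvoiding321-1324 (wordOf {n} g)
avoider⇒word {n} {g} A = perm , fishburn′ , ¬321 , ¬1324
  where
  open FishburnAvoider A
  value : ∀ i → toℕ (lookup (wordOf g) i) ≡ g (toℕ i)
  value i = toℕ-lookup-wordOf g i (bounded (toℕ<n i))
  value-< : ∀ {i j} → lookup (wordOf g) i <at lookup (wordOf g) j → g (toℕ i) < g (toℕ j)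
  value-< {i} {j} = subst₂ _<_ (value i) (value j)
  perm : IsPerm (wordOf g)
  perm i j eq = toℕ-injective (injective (toℕ<n i) (toℕ<n j)
    (trans (sym (value i)) (trans (cong toℕ eq) (value j))))
  fishburn′ : IsFishburn (wordOf g)
  fishburn′ (i , j , i+1 , i+1≡ , i<j , _ , fi<fi+1 , fi≡fj+1) =
    fishburn i<j (toℕ<n j) (subst (_< n) i+1≡ (toℕ<n i+1))
      (subst (g (toℕ i) <_) (cong g i+1≡) (value-< fi<fi+1))
      (trans (sym (value i)) (trans fi≡fj+1 (cong suc (value j))))
  ¬321 : ¬ Contains321 (wordOf g)
  ¬321 (i , j , k , i<j , j<k , πj<πi , πk<πj) =
    avoids321 i<j j<k (toℕ<n k) (value-< πj<πi) (value-< πk<πj)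
  ¬1324 : ¬ Contains1324 (wordOf g)
  ¬1324 (i , j , k , l , i<j , j<k , k<l , πi<πk , πk<πj , πj<πl) =
    avoids1324 i<j j<k k<l (toℕ<n l) (value-< πi<πk) (value-< πk<πj) (value-< πj<πl)

≡wordOf : ∀ {n} (π : Word n) {g} → AgreeBelow n (at π) g → π ≡ wordOf g
≡wordOf π {g} agree = trans (sym (tabulate∘lookup π)) (tabulate-cong λ i →
  let πi≡gi = trans (sym (at-lookup π i)) (agree (toℕ<n i)) in
  toℕ-injective (trans πi≡gi (sym (toℕ-clamp i (subst (_< _) πi≡gi (toℕ<n _))))))

skip : ℕ → ℕ → ℕ
skip k p with p <? k
... | yes _ = p
... | no _  = suc p

skip-< : ∀ {k p} → p < k → skip k p ≡ p
skip-< {k} {p} p<k with p <? k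
... | yes _   = refl
... | no p≮k = contradiction p<k p≮k

skip-≥ : ∀ {k p} → k ≤ p → skip k p ≡ suc p
skip-≥ {k} {p} k≤p with p <? k
... | yes p<k = contradiction k≤p (<⇒≱ p<k)
... | no _    = refl

skip-≢ : ∀ k p → skip k p ≢ k
skip-≢ k p with p <? k
... | yes p<k = <⇒≢ p<k
... | no p≮k  = λ p+1≡k → p≮k (subst (p <_) p+1≡k (n<1+n p))

≤-skip : ∀ k p → p ≤ skip k p
≤-skip k p with p <? k
... | yes _ = ≤-refl
... | no _  = n≤1+n p

skip-≤-suc : ∀ k p → skip k p ≤ suc p
skip-≤-suc k p with p <? k
... | yes _ = n≤1+n p
... | no _  = ≤-refl

skip-mono-< : ∀ k {a b} → a < b → skip k a < skip k b
skip-mono-< k {a} {b} a<b with a <? k | b <? k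
... | yes _   | yes _   = a<b
... | yes _   | no _    = <-trans a<b (n<1+n b)
... | no a≮k  | yes b<k = contradiction (<-trans a<b b<k) a≮k
... | no _    | no _    = s<s a<b

skip-injective : ∀ k {a b} → skip k a ≡ skip k b → a ≡ b
skip-injective k {a} {b} eq with <-cmp a b
... | tri< a<b _ _ = contradiction eq (<⇒≢ (skip-mono-< k a<b))
... | tri≈ _ a≡b _ = a≡b
... | tri> _ _ b<a = contradiction (sym eq) (<⇒≢ (skip-mono-< k b<a))

skip-surjective : ∀ k v → v ≢ k → ∃ λ p → skip k p ≡ v
skip-surjective k v v≢k with v <? k
... | yes v<k = v , skip-< v<k
skip-surjective k zero    v≢k | no v≮k = contradiction (n≢0⇒n>0 (λ k≡0 → v≢k (sym k≡0))) v≮k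
skip-surjective k (suc v) v≢k | no v≮k =
  v , skip-≥ (s≤s⁻¹ (≤∧≢⇒< (≮⇒≥ v≮k) (λ k≡v+1 → v≢k (sym k≡v+1))))

skip<⊎>skip : ∀ k p → skip k p < k ⊎ k < skip k p
skip<⊎>skip k p with <-cmp (skip k p) k
... | tri< lt _ _ = inj₁ lt
... | tri≈ _ eq _ = contradiction eq (skip-≢ k p)
... | tri> _ _ gt = inj₂ gt

-- The two families

-- k, then the values [0, top] ∖ {k} in increasing order, except that top sits at position q + 1.
topInsertion : ℕ → ℕ → ℕ → ℕ → ℕ
topInsertion top k q zero    = k
topInsertion top k q (suc p) with <-cmp p q
... | tri< _ _ _ = skip k p
... | tri≈ _ _ _ = top
... | tri> _ _ _ = skip k (pred p)

data TopInsertionPosition (q : ℕ) : ℕ → Set where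
  first  : TopInsertionPosition q 0
  before : ∀ p → p < q → TopInsertionPosition q (suc p)
  topPos : TopInsertionPosition q (suc q)
  after  : ∀ e → TopInsertionPosition q (suc (suc (q + e)))

topInsertionPosition : ∀ q p → TopInsertionPosition q p
topInsertionPosition q zero    = first
topInsertionPosition q (suc p) with <-cmp p q
... | tri< p<q _ _ = before p p<q
... | tri≈ _ refl _ = topPos
... | tri> _ _ q<p = subst (λ x → TopInsertionPosition q (suc x)) (m+[n∸m]≡n q<p) (after (p ∸ suc q))

module _ (top k q : ℕ) where
  topInsertion-before : ∀ {p} → p < q → topInsertion top k q (suc p) ≡ skip k p
  topInsertion-before {p} p<q with <-cmp p q
  ... | tri< _ _ _   = refl
  ... | tri≈ p≮q _ _ = contradiction p<q p≮q
  ... | tri> p≮q _ _ = contradiction p<q p≮q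

  topInsertion-top : topInsertion top k q (suc q) ≡ top
  topInsertion-top with <-cmp q q
  ... | tri< _ q≢q _ = contradiction refl q≢q
  ... | tri≈ _ _ _   = refl
  ... | tri> _ q≢q _ = contradiction refl q≢q

  topInsertion-after : ∀ e → topInsertion top k q (suc (suc (q + e))) ≡ skip k (q + e)
  topInsertion-after e with <-cmp (suc (q + e)) q
  ... | tri< lt _ _ = contradiction lt (<-asym (s≤s (m≤m+n q e)))
  ... | tri≈ _ eq _ = contradiction (sym eq) (<⇒≢ (s≤s (m≤m+n q e)))
  ... | tri> _ _ _  = refl

module TopInsertion (top k q : ℕ) (k<top : k < top) (q<top : q < top) (k≡0⊎1≤q : k ≡ 0 ⊎ 1 ≤ q) where
  private
    n : ℕ
    n = suc top
    g : ℕ → ℕ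
    g = topInsertion top k q

    skip<top : ∀ {p} → suc p < top → skip k p < top
    skip<top {p} p+1<top = ≤-<-trans (skip-≤-suc k p) p+1<top

  bounded : Bounded n g
  bounded {p} p<n with topInsertionPosition q p
  ... | first      = <-trans k<top (n<1+n top)
  ... | before p p<q rewrite topInsertion-before top k q p<q = <-trans (skip<top (<-≤-trans (s≤s p<q) q<top)) (n<1+n top)
  ... | topPos     rewrite topInsertion-top top k q = n<1+n top
  ... | after e    rewrite topInsertion-after top k q e = <-trans (skip<top (s<s⁻¹ p<n)) (n<1+n top)

  ascent⊎descent : ∀ {a b} → a < b → b < n → g a < g b ⊎ (g b < g a × (a ≡ 0 ⊎ g a ≡ top))
  ascent⊎descent {a} {b} a<b b<n with topInsertionPosition q a | topInsertionPosition q b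
  ... | _ | first = contradiction a<b n≮0
  ... | first | before p p<q rewrite topInsertion-before top k q p<q with skip<⊎>skip k p
  ...   | inj₁ lt = inj₂ (lt , inj₁ refl)
  ...   | inj₂ gt = inj₁ gt
  ascent⊎descent a<b b<n | first | topPos rewrite topInsertion-top top k q = inj₁ k<top
  ascent⊎descent a<b b<n | first | after e rewrite topInsertion-after top k q e with skip<⊎>skip k (q + e)
  ...   | inj₁ lt = inj₂ (lt , inj₁ refl)
  ...   | inj₂ gt = inj₁ gt
  ascent⊎descent a<b b<n | before p p<q | before p′ p′<q
    rewrite topInsertion-before top k q p<q | topInsertion-before top k q p′<q = inj₁ (skip-mono-< k (s<s⁻¹ a<b))
  ascent⊎descent a<b b<n | before p p<q | topPos
    rewrite topInsertion-before top k q p<q | topInsertion-top top k q = inj₁ (skip<top (<-≤-trans (s≤s p<q) q<top))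
  ascent⊎descent a<b b<n | before p p<q | after e
    rewrite topInsertion-before top k q p<q | topInsertion-after top k q e = inj₁ (skip-mono-< k (<-≤-trans p<q (m≤m+n q e)))
  ascent⊎descent a<b b<n | topPos | before p p<q = contradiction (s<s⁻¹ a<b) (<-asym p<q)
  ascent⊎descent a<b b<n | topPos | topPos = ⊥-elim (<-irrefl refl a<b)
  ascent⊎descent a<b b<n | topPos | after e
    rewrite topInsertion-top top k q | topInsertion-after top k q e = inj₂ (skip<top (s<s⁻¹ b<n) , inj₂ refl)
  ascent⊎descent a<b b<n | after e | before p p<q =
    contradiction (≤-<-trans (≤-trans (m≤m+n q e) (n≤1+n _)) (s<s⁻¹ a<b)) (<-asym p<q)
  ascent⊎descent a<b b<n | after e | topPos =
    ⊥-elim (<-irrefl refl (<-≤-trans (s≤s (m≤m+n q e)) (s≤s⁻¹ (≤-trans (n≤1+n _) a<b))))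
  ascent⊎descent a<b b<n | after e | after e′
    rewrite topInsertion-after top k q e | topInsertion-after top k q e′ = inj₁ (skip-mono-< k (s<s⁻¹ (s<s⁻¹ a<b)))

  injective : InjectiveBelow n g
  injective = injectiveBelow λ a<b b<n → [ <⇒≢ , (λ (gb<ga , _) → ≢-sym (<⇒≢ gb<ga)) ]′ (ascent⊎descent a<b b<n)

  avoider : FishburnAvoider n g
  avoider = record
    { bounded    = bounded
    ; injective  = injective
    ; avoids321  = λ {a} {b} {c} a<b b<c c<n gb<ga gc<gb →
        ¬interior-descent {a} {b} {c} {a} a<b (ascent⊎descent b<c c<n) gc<gb (bounded (<-trans a<b (<-trans b<c c<n))) gb<ga
    ; avoids1324 = λ {a} {b} {c} {d} a<b b<c c<d d<n _ gc<gb gb<gd →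
        ¬interior-descent {a} {b} {c} {d} a<b (ascent⊎descent b<c (<-trans c<d d<n)) gc<gb (bounded d<n) gb<gd
    ; fishburn   = λ {i} {j} i<j j<n i+1<n gi<gi+1 gi≡gj+1 →
        no-fishburn {i} {j} i<j (ascent⊎descent i<j j<n) gi<gi+1 gi≡gj+1 (bounded i+1<n)
    }
    where
    -- A descent at a position b > 0 starts at top, which is never below another value.
    ¬interior-descent : ∀ {a b c d} → a < b → g b < g c ⊎ (g c < g b × (b ≡ 0 ⊎ g b ≡ top)) →
                        g c < g b → g d < n → g b < g d → ⊥
    ¬interior-descent a<b (inj₁ gb<gc) gc<gb _ _ = <-asym gb<gc gc<gb
    ¬interior-descent a<b (inj₂ (_ , inj₁ refl)) _ _ _ = n≮0 a<b
    ¬interior-descent a<b (inj₂ (_ , inj₂ gb≡top)) _ gd<n gb<gd = <⇒≱ (subst (_< _) gb≡top gb<gd) (s≤s⁻¹ gd<n)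

    no-fishburn : ∀ {i j} → i < j → g i < g j ⊎ (g j < g i × (i ≡ 0 ⊎ g i ≡ top)) →
                  g i < g (suc i) → g i ≡ suc (g j) → g (suc i) < n → ⊥
    no-fishburn {i} {j} _ (inj₁ gi<gj) _ gi≡gj+1 _ = <-asym gi<gj (subst (g j <_) (sym gi≡gj+1) (n<1+n _))
    no-fishburn {zero} {j} _ (inj₂ (_ , inj₁ _)) k<g1 k≡gj+1 _ = fishburn-at-0 k≡0⊎1≤q
      where
      fishburn-at-0 : k ≡ 0 ⊎ 1 ≤ q → ⊥
      fishburn-at-0 (inj₁ k≡0) = 0≢1+n (trans (sym k≡0) k≡gj+1)
      fishburn-at-0 (inj₂ 1≤q) = n≮0 (subst (k <_) g1≡0 k<g1)
        where
        g1≡0 : g 1 ≡ 0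
        g1≡0 = trans (topInsertion-before top k q 1≤q) (skip-< (subst (0 <_) (sym k≡gj+1) z<s))
    no-fishburn {suc i} _ (inj₂ (_ , inj₁ ())) _ _ _
    no-fishburn {i} _ (inj₂ (_ , inj₂ gi≡top)) gi<gi+1 _ gi+1<n =
      <⇒≱ (subst (_< g (suc i)) gi≡top gi<gi+1) (s≤s⁻¹ gi+1<n)

-- k, then 0, …, j - 1, then k + 1, …, k + h, then j, j + 1, … .
blockRotation : ℕ → ℕ → ℕ → ℕ → ℕ
blockRotation k h j zero = k
blockRotation k h j (suc p) with p <? j
... | yes _ = p
... | no _ with p ∸ j <? h
...   | yes _ = suc (k + (p ∸ j))
...   | no _  = j + (p ∸ j ∸ h)

data BlockRotationPosition (j h : ℕ) : ℕ → Set where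
  first : BlockRotationPosition j h 0
  low   : ∀ p → p < j → BlockRotationPosition j h (suc p)
  high  : ∀ d → d < h → BlockRotationPosition j h (suc (j + d))
  rest  : ∀ e → BlockRotationPosition j h (suc (j + h + e))

blockRotationPosition : ∀ j h p → BlockRotationPosition j h p
blockRotationPosition j h zero = first
blockRotationPosition j h (suc p) with p <? j
... | yes p<j = low p p<j
... | no p≮j with p ∸ j <? h
...   | yes d<h = subst (λ x → BlockRotationPosition j h (suc x)) (m+[n∸m]≡n (≮⇒≥ p≮j)) (high (p ∸ j) d<h)
...   | no d≮h = subst (λ x → BlockRotationPosition j h (suc x)) j+h+e≡p (rest (p ∸ j ∸ h))
  where
  j+h+e≡p : j + h + (p ∸ j ∸ h) ≡ p
  j+h+e≡p = trans (+-assoc j h _) (trans (cong (j +_) (m+[n∸m]≡n (≮⇒≥ d≮h))) (m+[n∸m]≡n (≮⇒≥ p≮j)))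

module _ (k h j : ℕ) where
  blockRotation-low : ∀ {p} → p < j → blockRotation k h j (suc p) ≡ p
  blockRotation-low {p} p<j with p <? j
  ... | yes _   = refl
  ... | no p≮j = contradiction p<j p≮j

  blockRotation-high : ∀ {d} → d < h → blockRotation k h j (suc (j + d)) ≡ suc (k + d)
  blockRotation-high {d} d<h with j + d <? j
  ... | yes j+d<j = contradiction j+d<j (m+n≮m j d)
  ... | no _ with j + d ∸ j <? h
  ...   | yes _   = cong (λ x → suc (k + x)) (m+n∸m≡n j d)
  ...   | no d≮h = contradiction (subst (_< h) (sym (m+n∸m≡n j d)) d<h) d≮h

  blockRotation-rest : ∀ e → blockRotation k h j (suc (j + h + e)) ≡ j + e
  blockRotation-rest e with j + h + e <? j
  ... | yes lt = contradiction lt (≤⇒≯ (≤-trans (m≤m+n j h) (m≤m+n (j + h) e)))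
  ... | no _ with j + h + e ∸ j <? h
  ...   | yes lt = contradiction (subst (_< h) h+e≡ lt) (≤⇒≯ (m≤m+n h e))
    where
    h+e≡ : j + h + e ∸ j ≡ h + e
    h+e≡ = trans (cong (_∸ j) (+-assoc j h e)) (m+n∸m≡n j (h + e))
  ...   | no _ = cong (j +_) (trans (cong (_∸ h) (trans (cong (_∸ j) (+-assoc j h e)) (m+n∸m≡n j (h + e)))) (m+n∸m≡n h e))

  blockRotation-afterLow : 1 ≤ h → blockRotation k h j (suc j) ≡ suc k
  blockRotation-afterLow 1≤h = trans (cong (λ x → blockRotation k h j (suc x)) (sym (+-identityʳ j)))
                                     (trans (blockRotation-high 1≤h) (cong suc (+-identityʳ k)))

  blockRotation-afterHigh : blockRotation k h j (suc (j + h)) ≡ j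
  blockRotation-afterHigh = trans (cong (λ x → blockRotation k h j (suc x)) (sym (+-identityʳ (j + h))))
                                  (trans (blockRotation-rest 0) (+-identityʳ j))

module BlockRotation (top k h j : ℕ) (top≡k+h : top ≡ k + h) (j≤k : j ≤ k)
                     (1≤j⊎j≡h≡0 : 1 ≤ j ⊎ (j ≡ 0 × h ≡ 0)) where
  private
    n : ℕ
    n = suc top
    g : ℕ → ℕ
    g = blockRotation k h j

    k≤top : k ≤ top
    k≤top = subst (k ≤_) (sym top≡k+h) (m≤m+n k h)

    high≤top : ∀ {d} → d < h → suc (k + d) ≤ top
    high≤top {d} d<h = subst (suc (k + d) ≤_) (sym top≡k+h) (subst (_≤ k + h) (+-suc k d) (+-monoʳ-≤ k d<h))

  rest<k : ∀ e → suc (j + h + e) < n → j + e < k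
  rest<k e p<n = +-cancelʳ-< h (j + e) k (subst₂ _<_ reassoc top≡k+h (s<s⁻¹ p<n))
    where
    reassoc : j + h + e ≡ j + e + h
    reassoc = trans (+-assoc j h e) (trans (cong (j +_) (+-comm h e)) (sym (+-assoc j e h)))

  bounded : Bounded n g
  bounded {p} p<n with blockRotationPosition j h p
  ... | first = s≤s k≤top
  ... | low p p<j rewrite blockRotation-low k h j p<j = s≤s (≤-trans (<⇒≤ (<-≤-trans p<j j≤k)) k≤top)
  ... | high d d<h rewrite blockRotation-high k h j d<h = s≤s (high≤top d<h)
  ... | rest e rewrite blockRotation-rest k h j e = s≤s (≤-trans (<⇒≤ (rest<k e p<n)) k≤top)

  rest-below-k : ∀ e x → suc (j + h + e) ≤ x → x < n → g x < k
  rest-below-k e x p≤x x<n with blockRotationPosition j h x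
  ... | first = contradiction p≤x (λ ())
  ... | low p p<j = ⊥-elim (<-irrefl refl (<-≤-trans p<j (≤-trans (≤-trans (m≤m+n j h) (m≤m+n (j + h) e)) (s≤s⁻¹ p≤x))))
  ... | high d d<h = ⊥-elim (<-irrefl refl (<-≤-trans (+-monoʳ-< j d<h) (≤-trans (m≤m+n (j + h) e) (s≤s⁻¹ p≤x))))
  ... | rest e′ rewrite blockRotation-rest k h j e′ = rest<k e′ x<n

  DescentStart : ℕ → ℕ → Set
  DescentStart a b = a ≡ 0 ⊎ (k < g a × (∀ x → b ≤ x → x < n → g x < k))

  ascent⊎descent : ∀ {a b} → a < b → b < n → g a < g b ⊎ (g b < g a × DescentStart a b)
  ascent⊎descent {a} {b} a<b b<n with blockRotationPosition j h a | blockRotationPosition j h b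
  ... | _ | first = contradiction a<b n≮0
  ... | first | low p p<j rewrite blockRotation-low k h j p<j = inj₂ (<-≤-trans p<j j≤k , inj₁ refl)
  ... | first | high d d<h rewrite blockRotation-high k h j d<h = inj₁ (s≤s (m≤m+n k d))
  ... | first | rest e rewrite blockRotation-rest k h j e = inj₂ (rest<k e b<n , inj₁ refl)
  ... | low p p<j | low p′ p′<j
    rewrite blockRotation-low k h j p<j | blockRotation-low k h j p′<j = inj₁ (s<s⁻¹ a<b)
  ... | low p p<j | high d d<h
    rewrite blockRotation-low k h j p<j | blockRotation-high k h j d<h = inj₁ (<-trans (<-≤-trans p<j j≤k) (s≤s (m≤m+n k d)))
  ... | low p p<j | rest e
    rewrite blockRotation-low k h j p<j | blockRotation-rest k h j e = inj₁ (<-≤-trans p<j (m≤m+n j e))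
  ... | high d d<h | low p p<j = ⊥-elim (<-irrefl refl (<-trans p<j (≤-<-trans (m≤m+n j d) (s<s⁻¹ a<b))))
  ... | high d d<h | high d′ d′<h
    rewrite blockRotation-high k h j d<h | blockRotation-high k h j d′<h = inj₁ (s<s (+-monoʳ-< k (+-cancelˡ-< j d d′ (s<s⁻¹ a<b))))
  ... | high d d<h | rest e
    rewrite blockRotation-high k h j d<h | blockRotation-rest k h j e =
      inj₂ (<-trans (rest<k e b<n) (s≤s (m≤m+n k d)) , inj₂ (s≤s (m≤m+n k d) , rest-below-k e))
  ... | rest e | low p p<j =
      ⊥-elim (<-irrefl refl (<-trans p<j (≤-<-trans (≤-trans (m≤m+n j h) (m≤m+n (j + h) e)) (s<s⁻¹ a<b))))
  ... | rest e | high d d<h =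
      ⊥-elim (<-irrefl refl (<-trans (+-monoʳ-< j d<h) (≤-<-trans (m≤m+n (j + h) e) (s<s⁻¹ a<b))))
  ... | rest e | rest e′
    rewrite blockRotation-rest k h j e | blockRotation-rest k h j e′ = inj₁ (+-monoʳ-< j (+-cancelˡ-< (j + h) e e′ (s<s⁻¹ a<b)))

  second≡0 : g 1 ≡ 0
  second≡0 = from 1≤j⊎j≡h≡0
    where
    from : 1 ≤ j ⊎ (j ≡ 0 × h ≡ 0) → g 1 ≡ 0
    from (inj₁ 1≤j) = blockRotation-low k h j 1≤j
    from (inj₂ (j≡0 , h≡0)) =
      trans (cong (λ x → g (suc x)) (sym (trans (+-identityʳ (j + h)) (cong₂ _+_ j≡0 h≡0))))
            (trans (blockRotation-rest k h j 0) (trans (+-identityʳ j) j≡0))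

  injective : InjectiveBelow n g
  injective = injectiveBelow λ a<b b<n → [ <⇒≢ , (λ (gb<ga , _) → ≢-sym (<⇒≢ gb<ga)) ]′ (ascent⊎descent a<b b<n)

  avoider : FishburnAvoider n g
  avoider = record
    { bounded    = bounded
    ; injective  = injective
    ; avoids321  = λ {a} {b} {c} a<b b<c c<n gb<ga gc<gb →
        no-321 {a} {b} {c} a<b b<c c<n (ascent⊎descent a<b (<-trans b<c c<n)) (ascent⊎descent b<c c<n) gb<ga gc<gb
    ; avoids1324 = λ {a} {b} {c} {d} a<b b<c c<d d<n _ gc<gb gb<gd →
        no-1324 {a} {b} {c} {d} a<b c<d d<n (ascent⊎descent b<c (<-trans c<d d<n)) gc<gb gb<gd
    ; fishburn   = λ {i} {j} i<j j<n _ gi<gi+1 gi≡gj+1 →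
        no-fishburn {i} {j} j<n (ascent⊎descent i<j j<n) gi<gi+1 gi≡gj+1
    }
    where
    no-321 : ∀ {a b c} → a < b → b < c → c < n →
             g a < g b ⊎ (g b < g a × DescentStart a b) → g b < g c ⊎ (g c < g b × DescentStart b c) →
             g b < g a → g c < g b → ⊥
    no-321 _ _ _ _ (inj₁ gb<gc) _ gc<gb = <-asym gb<gc gc<gb
    no-321 a<b _ _ _ (inj₂ (_ , inj₁ refl)) _ _ = n≮0 a<b
    no-321 _ _ _ (inj₁ ga<gb) (inj₂ _) gb<ga _ = <-asym ga<gb gb<ga
    no-321 _ _ _ (inj₂ (_ , inj₁ refl)) (inj₂ (_ , inj₂ (k<gb , _))) gb<ga _ = <-asym k<gb gb<ga
    no-321 {b = b} _ b<c c<n (inj₂ (_ , inj₂ (_ , after-a<k))) (inj₂ (_ , inj₂ (k<gb , _))) _ _ =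
      <-asym k<gb (after-a<k b ≤-refl (<-trans b<c c<n))
    no-1324 : ∀ {a b c d} → a < b → c < d → d < n →
              g b < g c ⊎ (g c < g b × DescentStart b c) → g c < g b → g b < g d → ⊥
    no-1324 _ _ _ (inj₁ gb<gc) gc<gb _ = <-asym gb<gc gc<gb
    no-1324 a<b _ _ (inj₂ (_ , inj₁ refl)) _ _ = n≮0 a<b
    no-1324 {d = d} _ c<d d<n (inj₂ (_ , inj₂ (k<gb , after-b<k))) _ gb<gd =
      <-asym (<-trans k<gb gb<gd) (after-b<k d (<⇒≤ c<d) d<n)
    no-fishburn : ∀ {i j} → j < n → g i < g j ⊎ (g j < g i × DescentStart i j) →
                  g i < g (suc i) → g i ≡ suc (g j) → ⊥
    no-fishburn {j = j} _ (inj₁ gi<gj) _ gi≡gj+1 = <-asym gi<gj (subst (g j <_) (sym gi≡gj+1) (n<1+n _))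
    no-fishburn {zero} _ (inj₂ (_ , inj₁ _)) g0<g1 _ = n≮0 (subst (g 0 <_) second≡0 g0<g1)
    no-fishburn {suc i} _ (inj₂ (_ , inj₁ ())) _ _
    no-fishburn {j = j} j<n (inj₂ (_ , inj₂ (k<gi , after-i<k))) _ gi≡gj+1 =
      <⇒≱ k<gi (subst (_≤ k) (sym gi≡gj+1) (after-i<k j ≤-refl j<n))

data Shape : Set where
  insertion : (k q : ℕ) → Shape
  rotation  : (k j : ℕ) → Shape

shapeFn : ℕ → Shape → ℕ → ℕ
shapeFn top (insertion k q) = topInsertion top k q
shapeFn top (rotation k j)  = blockRotation k (top ∸ k) j

ValidShape : ℕ → Shape → Set
ValidShape top (insertion k q) = k < top × q < top × (k ≡ 0 ⊎ 1 ≤ q)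
ValidShape top (rotation k j)  = (k ≡ top × j ≡ 0) ⊎ (1 ≤ j × j < k × 2 + k ≤ top)

shape-avoider : ∀ {top} σ → ValidShape top σ → FishburnAvoider (suc top) (shapeFn top σ)
shape-avoider {top} (insertion k q) (k<top , q<top , k≡0⊎1≤q) = TopInsertion.avoider top k q k<top q<top k≡0⊎1≤q
shape-avoider {top} (rotation k j) (inj₁ (refl , refl)) =
  BlockRotation.avoider top top (top ∸ top) 0 (sym (m+[n∸m]≡n ≤-refl)) z≤n (inj₂ (refl , n∸n≡0 top))
shape-avoider {top} (rotation k j) (inj₂ (1≤j , j<k , 2+k≤top)) =
  BlockRotation.avoider top k (top ∸ k) j (sym (m+[n∸m]≡n (≤-trans (n≤1+n _) (≤-trans (n≤1+n _) 2+k≤top)))) (<⇒≤ j<k) (inj₁ 1≤j)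

-- Every permutation of the class belongs to one of the families

module Classification {top : ℕ} (2≤top : 2 ≤ top) {f : ℕ → ℕ} (F : FishburnAvoider (suc top) f) where
  open FishburnAvoider F

  private
    n : ℕ
    n = suc top
    k : ℕ
    k = f 0

    k<n : k < n
    k<n = bounded z<s

    1<n : 1 < n
    1<n = s≤s (≤-trans (s≤s z≤n) 2≤top)

    suc-pred′ : ∀ {m} → 1 ≤ m → suc (pred m) ≡ m
    suc-pred′ 1≤m = suc-pred _ {{>-nonZero 1≤m}}

  surjective : ∀ {v} → v < n → ∃ λ i → i < n × f i ≡ v
  surjective = bounded-injective⇒surjective bounded injective

  placedAfter : ∀ {g} → InjectiveBelow n g → ∀ {P P′ x} → AgreeBelow P f g → P ≤ P′ → P′ < n →
                g P′ ≡ x → x ≢ f P → x < n → ∃ λ r → P < r × r < n × f r ≡ x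
  placedAfter {g} g-injective {P} {P′} {x} agree P≤P′ P′<n gP′≡x x≢fP x<n =
    let r , r<n , fr≡x = surjective x<n in r , P<r r<n fr≡x , r<n , fr≡x
    where
    P<r : ∀ {r} → r < n → f r ≡ x → P < r
    P<r {r} r<n fr≡x with <-cmp r P
    ... | tri< r<P _ _ = contradiction (g-injective r<n P′<n (trans (sym (agree r<P)) (trans fr≡x (sym gP′≡x))))
                                       (<⇒≢ (<-≤-trans r<P P≤P′))
    ... | tri≈ _ refl _ = contradiction (sym fr≡x) x≢fP
    ... | tri> _ _ P<r = P<r

  -- If f (P+1) > f P we get a Fishburn pattern with the predecessor, if f (P+1) < f P a 1324 with 0 and top.
  ¬pred-and-top-after : ∀ {z P a b} → z < P → f z ≡ 0 → f P < top →
                        P < a → a < n → suc (f a) ≡ f P → P < b → b < n → f b ≡ top → ⊥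
  ¬pred-and-top-after {z} {P} {a} {b} z<P fz≡0 fP<top P<a a<n fa+1≡fP P<b b<n fb≡top
    with <-cmp (f (suc P)) (f P)
  ... | tri≈ _ eq _ = contradiction (injective P+1<n (<-trans P<a a<n) eq) (1+n≢n)
    where
    P+1<n : suc P < n
    P+1<n = ≤-<-trans P<a a<n
  ... | tri> _ _ fP<fP+1 = fishburn P<a a<n (≤-<-trans P<a a<n) fP<fP+1 (sym fa+1≡fP)
  ... | tri< fP+1<fP _ _ =
    avoids1324 z<P (n<1+n P) P+1<b b<n (subst (_< f (suc P)) (sym fz≡0) (n≢0⇒n>0 fP+1≢0)) fP+1<fP
      (subst (f P <_) (sym fb≡top) fP<top)
    where
    fP+1≢0 : f (suc P) ≢ 0
    fP+1≢0 eq = contradiction (injective (<-trans z<P (<-trans P<b b<n)) (≤-<-trans P<b b<n) (trans fz≡0 (sym eq)))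
                            (<⇒≢ (<-trans z<P (n<1+n P)))
    P+1<b : suc P < b
    P+1<b = ≤∧≢⇒< P<b λ P+1≡b → <-asym (subst (_< f P) (trans (cong f P+1≡b) fb≡top) fP+1<fP) fP<top

  -- k > f 1 > 0 would be a 321 with the value 0; f 1 > k a Fishburn pattern with the value k - 1.
  second≡0 : 1 ≤ k → f 1 ≡ 0
  second≡0 1≤k with f 1 ≟ 0
  ... | yes f1≡0 = f1≡0
  ... | no f1≢0 with <-cmp (f 1) k
  ...   | tri≈ _ f1≡k _ = contradiction (injective z<s 1<n (sym f1≡k)) 0≢1+n
  ...   | tri< f1<k _ _ =
    let r , r<n , fr≡0 = surjective {0} z<s
    in ⊥-elim (avoids321 z<s (1<r fr≡0) r<n f1<k (subst (_< f 1) (sym fr≡0) (n≢0⇒n>0 f1≢0)))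
    where
    1<r : ∀ {r} → f r ≡ 0 → 1 < r
    1<r {zero}          fr≡0 = contradiction (subst (1 ≤_) fr≡0 1≤k) λ ()
    1<r {suc zero}      fr≡0 = contradiction fr≡0 f1≢0
    1<r {suc (suc _)}   _    = s<s z<s
  ...   | tri> _ _ k<f1 =
    let r , r<n , fr≡k-1 = surjective (≤-<-trans pred[n]≤n k<n)
    in ⊥-elim (fishburn (0<r fr≡k-1) r<n 1<n k<f1 (trans (sym (suc-pred′ 1≤k)) (cong suc (sym fr≡k-1))))
    where
    0<r : ∀ {r} → f r ≡ pred k → 0 < r
    0<r {zero}  k≡k-1 = contradiction (sym k≡k-1) (<⇒≢ (subst (_≤ k) (sym (suc-pred′ 1≤k)) ≤-refl))
    0<r {suc _} _     = z<s

  notBefore : ∀ {g P r} → AgreeBelow P f g → P < n → r < n → g r ≡ f P → P ≤ r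
  notBefore {P = P} {r} agree P<n r<n gr≡fP with r <? P
  ... | yes r<P = contradiction (injective r<n P<n (trans (agree r<P) gr≡fP)) (<⇒≢ r<P)
  ... | no r≮P  = ≮⇒≥ r≮P

  -- Each value f P already occurs in g at some r ≥ P; it suffices to rule out r > P.
  forced : ∀ {g} → Bounded n g → InjectiveBelow n g → ∀ {P₀} → AgreeBelow P₀ f g → P₀ ≤ n →
           (∀ {P r} → AgreeBelow P f g → P₀ ≤ P → P < r → r < n → g r ≡ f P → ⊥) → AgreeBelow n f g
  forced {g} g-bounded g-injective {P₀} agree₀ P₀≤n ¬later = go (n ∸ P₀) agree₀ ≤-refl (m+[n∸m]≡n P₀≤n)
    where
    go : ∀ d {P} → AgreeBelow P f g → P₀ ≤ P → P + d ≡ n → AgreeBelow n f g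
    go zero {P} agree _ P+0≡n = subst (λ m → AgreeBelow m f g) (trans (sym (+-identityʳ P)) P+0≡n) agree
    go (suc d) {P} agree P₀≤P P+d+1≡n =
      go d (extend agree (fP≡gP (bounded-injective⇒surjective g-bounded g-injective (bounded P<n))))
           (m≤n⇒m≤1+n P₀≤P) (trans (sym (+-suc P d)) P+d+1≡n)
      where
      P<n : P < n
      P<n = subst (P <_) P+d+1≡n (m<m+n P z<s)
      fP≡gP : (∃ λ r → r < n × g r ≡ f P) → f P ≡ g P
      fP≡gP (r , r<n , gr≡fP) with m≤n⇒m<n∨m≡n (notBefore agree P<n r<n gr≡fP)
      ... | inj₁ P<r  = ⊥-elim (¬later agree P₀≤P P<r r<n gr≡fP)
      ... | inj₂ refl = sym gr≡fP

  ascending : ℕ → ℕ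
  ascending zero    = k
  ascending (suc p) = skip k p

  ascending-injective : InjectiveBelow n ascending
  ascending-injective {zero}  {zero}  _ _ _  = refl
  ascending-injective {zero}  {suc j} _ _ eq = contradiction (sym eq) (skip-≢ k j)
  ascending-injective {suc i} {zero}  _ _ eq = contradiction eq (skip-≢ k i)
  ascending-injective {suc i} {suc j} _ _ eq = cong suc (skip-injective k eq)

  ascending-bounded : Bounded n ascending
  ascending-bounded {zero}  _     = k<n
  ascending-bounded {suc p} p+1<n = ≤-<-trans (skip-≤-suc k p) p+1<n

  ascending-reaches : ∀ {i x} → skip k i ≤ x → x ≢ k → x < n → ∃ λ r → i ≤ r × suc r < n × ascending (suc r) ≡ x
  ascending-reaches {i} {x} skip-i≤x x≢k x<n =
    let r , skip-r≡x = skip-surjective k x x≢k in r , i≤r skip-r≡x , s≤s (r<top skip-r≡x) , skip-r≡x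
    where
    i≤r : ∀ {r} → skip k r ≡ x → i ≤ r
    i≤r {r} skip-r≡x with r <? i
    ... | yes r<i = contradiction (skip-mono-< k r<i) (≤⇒≯ (subst (skip k i ≤_) (sym skip-r≡x) skip-i≤x))
    ... | no r≮i  = ≮⇒≥ r≮i
    r<top : ∀ {r} → skip k r ≡ x → r < top
    r<top {r} skip-r≡x with k ≤? r
    ... | yes k≤r = subst (_≤ top) (trans (sym skip-r≡x) (skip-≥ k≤r)) (s≤s⁻¹ x<n)
    ... | no k≰r  = <-≤-trans (≰⇒> k≰r) (s≤s⁻¹ k<n)

  placedAfterPrefix : ∀ {i x} → AgreeBelow (suc i) f ascending → skip k i ≤ x → x ≢ k → x ≢ f (suc i) → x < n →
                      ∃ λ r → suc i < r × r < n × f r ≡ x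
  placedAfterPrefix agree skip-i≤x x≢k x≢fi+1 x<n =
    let r , i≤r , r+1<n , ar≡x = ascending-reaches skip-i≤x x≢k x<n
    in placedAfter ascending-injective agree (s≤s i≤r) r+1<n ar≡x x≢fi+1 x<n

  data Next (i : ℕ) : Set where
    continues       : f (suc i) ≡ skip k i → Next i
    jumpsToTop      : f (suc i) ≡ top → skip k i < top → Next i
    jumpsAboveFirst : f (suc i) ≡ suc k → 1 ≤ i → i < k → suc k < top → Next i

  next : ∀ {i z} → AgreeBelow (suc i) f ascending → suc i < n → z < suc i → f z ≡ 0 → k ≡ 0 ⊎ 1 ≤ i → Next i
  next {i} {z} agree i+1<n z<i+1 fz≡0 k≡0⊎1≤i =
    let r , r<n , ar≡v = bounded-injective⇒surjective ascending-bounded ascending-injective (bounded i+1<n)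
    in from r r<n ar≡v (notBefore agree i+1<n r<n ar≡v)
    where
    v : ℕ
    v = f (suc i)
    from : ∀ r → r < n → ascending r ≡ v → suc i ≤ r → Next i
    from (suc r′) r<n ar≡v i+1≤r with <-cmp i r′
    ... | tri> _ _ r′<i = contradiction (s≤s⁻¹ i+1≤r) (<⇒≱ r′<i)
    ... | tri≈ _ refl _ = continues (sym ar≡v)
    ... | tri< i<r′ _ _ = beyond (subst (λ x → x < k ⊎ k < x) ar≡v (skip<⊎>skip k r′))
      where
      skip-i<v : skip k i < v
      skip-i<v = subst (skip k i <_) ar≡v (skip-mono-< k i<r′)

      -- A 321 with k once skip k i is placed after v.
      beyond : v < k ⊎ k < v → Next i
      beyond (inj₁ v<k) =
        let r₂ , i+1<r₂ , r₂<n , fr₂≡ = placedAfterPrefix agree ≤-refl (skip-≢ k i) (<⇒≢ skip-i<v)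
                                          (<-trans skip-i<v (bounded i+1<n))
        in ⊥-elim (avoids321 z<s i+1<r₂ r₂<n v<k (subst (_< v) (sym fr₂≡) skip-i<v))
      beyond (inj₂ k<v) with v ≟ top | v ≟ suc k
      ... | yes v≡top | _ = jumpsToTop v≡top (subst (skip k i <_) v≡top skip-i<v)
      ... | no v≢top | yes v≡k+1 = jumpsAboveFirst v≡k+1 1≤i i<k (subst (_< top) v≡k+1 v<top)
        where
        v<top : v < top
        v<top = ≤∧≢⇒< (s≤s⁻¹ (bounded i+1<n)) v≢top
        i<k : i < k
        i<k = ≤-<-trans (≤-skip k i) (≤∧≢⇒< (s≤s⁻¹ (subst (skip k i <_) v≡k+1 skip-i<v)) (skip-≢ k i))
        1≤i : 1 ≤ i
        1≤i = [ (λ k≡0 → contradiction (subst (i <_) k≡0 i<k) λ ()) , (λ 1≤i → 1≤i) ]′ k≡0⊎1≤i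
      ... | no v≢top | no v≢k+1 =
        let a , i+1<a , a<n , fa≡v-1 = placedAfterPrefix agree (pred-mono-≤ skip-i<v) v-1≢k (<⇒≢ v-1<v)
                                         (<-trans v-1<v (bounded i+1<n))
            b , i+1<b , b<n , fb≡top = placedAfterPrefix agree (<⇒≤ (<-trans skip-i<v v<top)) top≢k
                                         (≢-sym v≢top) (n<1+n top)
        in ⊥-elim (¬pred-and-top-after z<i+1 fz≡0 v<top i+1<a a<n (trans (cong suc fa≡v-1) (suc-pred′ 1≤v))
                                       i+1<b b<n fb≡top)
        where
        1≤v : 1 ≤ v
        1≤v = ≤-<-trans z≤n k<v
        v<top : v < top
        v<top = ≤∧≢⇒< (s≤s⁻¹ (bounded i+1<n)) v≢top
        v-1<v : pred v < v
        v-1<v = subst (pred v <_) (suc-pred′ 1≤v) ≤-refl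
        v-1≢k : pred v ≢ k
        v-1≢k v-1≡k = v≢k+1 (trans (sym (suc-pred′ 1≤v)) (cong suc v-1≡k))
        top≢k : top ≢ k
        top≢k top≡k = <-asym k<v (subst (v <_) top≡k v<top)

  data AscendingPrefix : Set where
    whole      : AgreeBelow n f ascending → AscendingPrefix
    topAfter   : ∀ q → AgreeBelow (suc q) f ascending → f (suc q) ≡ top → skip k q < top →
                 k ≡ 0 ⊎ 1 ≤ q → AscendingPrefix
    blockAfter : ∀ j → AgreeBelow (suc j) f ascending → f (suc j) ≡ suc k → 1 ≤ j → j < k →
                 suc k < top → AscendingPrefix

  ascendingPrefixFrom : ∀ d {i z} → AgreeBelow (suc i) f ascending → z < suc i → f z ≡ 0 → k ≡ 0 ⊎ 1 ≤ i →
         suc i + d ≡ n → AscendingPrefix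
  ascendingPrefixFrom zero    {i} agree _ _ _ i+1+0≡n =
    whole (subst (λ m → AgreeBelow m f ascending) (trans (sym (+-identityʳ (suc i))) i+1+0≡n) agree)
  ascendingPrefixFrom (suc d) {i} {z} agree z<i+1 fz≡0 k≡0⊎1≤i i+1+d+1≡n with next agree i+1<n z<i+1 fz≡0 k≡0⊎1≤i
    where
    i+1<n : suc i < n
    i+1<n = subst (suc i <_) i+1+d+1≡n (m<m+n (suc i) z<s)
  ... | continues eq = ascendingPrefixFrom d (extend agree eq) (<-trans z<i+1 (n<1+n _)) fz≡0 (inj₂ (s≤s z≤n))
                            (trans (sym (+-suc (suc i) d)) i+1+d+1≡n)
  ... | jumpsToTop eq skip<top = topAfter i agree eq skip<top k≡0⊎1≤i
  ... | jumpsAboveFirst eq 1≤i i<k k+1<top = blockAfter i agree eq 1≤i i<k k+1<top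

  ascendingPrefix : AscendingPrefix
  ascendingPrefix with k ≟ 0
  ... | yes k≡0 = ascendingPrefixFrom top agree₁ z<s k≡0 (inj₁ k≡0) refl
    where
    agree₁ : AgreeBelow 1 f ascending
    agree₁ {zero} _ = refl
    agree₁ {suc _} (s≤s ())
  ... | no k≢0 = ascendingPrefixFrom (pred top) agree₂ (n<1+n 1) (second≡0 1≤k) (inj₂ ≤-refl) (cong suc (suc-pred′ 1≤top))
    where
    1≤k : 1 ≤ k
    1≤k = n≢0⇒n>0 k≢0
    1≤top : 1 ≤ top
    1≤top = ≤-trans (s≤s z≤n) 2≤top
    agree₂ : AgreeBelow 2 f ascending
    agree₂ {zero}     _ = refl
    agree₂ {suc zero} _ = trans (second≡0 1≤k) (sym (skip-< 1≤k))
    agree₂ {suc (suc _)} (s≤s (s≤s ()))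

  module AfterTop (q : ℕ) (prefix : AgreeBelow (suc q) f ascending) (fq+1≡top : f (suc q) ≡ top)
                  (skip<top : skip k q < top) (k≡0⊎1≤q : k ≡ 0 ⊎ 1 ≤ q) where
    q<top : q < top
    q<top = ≤-<-trans (≤-skip k q) skip<top

    k<top : k < top
    k<top = ≤∧≢⇒< (s≤s⁻¹ k<n) λ k≡top → 0≢1+n (injective z<s (s≤s q<top) (trans k≡top (sym fq+1≡top)))

    private
      g : ℕ → ℕ
      g = topInsertion top k q
      module G = TopInsertion top k q k<top q<top k≡0⊎1≤q

      agree₀ : AgreeBelow (suc (suc q)) f g
      agree₀ {zero} _ = refl
      agree₀ {suc p} (s≤s p<q+1) with m≤n⇒m<n∨m≡n (s≤s⁻¹ p<q+1)
      ... | inj₁ p<q  = trans (prefix (s≤s p<q)) (sym (topInsertion-before top k q p<q))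
      ... | inj₂ refl = trans fq+1≡top (sym (topInsertion-top top k q))

      -- The skipped value g P would come after f P, below it and below top: a 321.
      ¬later : ∀ {P r} → AgreeBelow P f g → suc (suc q) ≤ P → P < r → r < n → g r ≡ f P → ⊥
      ¬later {P} {r} agree q+2≤P P<r r<n gr≡fP
        with e , refl ← m≤n⇒∃[o]m+o≡n q+2≤P
        with e′ , refl ← m≤n⇒∃[o]m+o≡n (<⇒≤ (≤-<-trans q+2≤P P<r)) =
        let r₂ , P<r₂ , r₂<n , fr₂≡gP = placedAfter G.injective agree ≤-refl P<n refl (<⇒≢ gP<fP) (G.bounded P<n)
        in avoids321 (<-≤-trans (n<1+n (suc q)) q+2≤P) P<r₂ r₂<n fP<top (subst (_< f P) (sym fr₂≡gP) gP<fP)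
        where
        P<n : P < n
        P<n = <-trans P<r r<n
        gP<fP : g P < f P
        gP<fP = subst₂ _<_ (sym (topInsertion-after top k q e))
                           (trans (sym (topInsertion-after top k q e′)) gr≡fP)
                           (skip-mono-< k (s<s⁻¹ (s<s⁻¹ P<r)))
        fP<top : f P < f (suc q)
        fP<top = subst (f P <_) (sym fq+1≡top) (≤∧≢⇒< (s≤s⁻¹ (bounded P<n))
                   λ fP≡top → contradiction (injective P<n (s≤s q<top) (trans fP≡top (sym fq+1≡top)))
                                            (≢-sym (<⇒≢ (<-≤-trans (n<1+n (suc q)) q+2≤P))))

    agree : AgreeBelow n f g
    agree = forced G.bounded G.injective agree₀ (s≤s q<top) ¬later

  module AfterBlock (j : ℕ) (prefix : AgreeBelow (suc j) f ascending) (fj+1≡k+1 : f (suc j) ≡ suc k)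
                    (1≤j : 1 ≤ j) (j<k : j < k) (k+1<top : suc k < top) where
    private
      h : ℕ
      h = top ∸ k

      top≡k+h : top ≡ k + h
      top≡k+h = sym (m+[n∸m]≡n (s≤s⁻¹ k<n))

      1≤h : 1 ≤ h
      1≤h = m<n⇒0<n∸m (<-trans (n<1+n k) k+1<top)

      g : ℕ → ℕ
      g = blockRotation k h j
      module G = BlockRotation top k h j top≡k+h (<⇒≤ j<k) (inj₁ 1≤j)

      f1≡0 : f 1 ≡ 0
      f1≡0 = trans (prefix (s≤s 1≤j)) (skip-< (≤-<-trans z≤n j<k))

      high<n : ∀ {d} → d < h → suc (j + d) < n
      high<n {d} d<h = s≤s (subst (j + d <_) (sym top≡k+h) (<-≤-trans (+-monoʳ-< j d<h) (+-monoˡ-≤ h (<⇒≤ j<k))))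

      topPosition : ℕ
      topPosition = suc (j + pred h)
      jPosition : ℕ
      jPosition = suc (j + h)

      h-1<h : pred h < h
      h-1<h = subst (pred h <_) (suc-pred′ 1≤h) ≤-refl

      g-topPosition : g topPosition ≡ top
      g-topPosition = trans (blockRotation-high k h j h-1<h)
                            (trans (sym (+-suc k (pred h))) (trans (cong (k +_) (suc-pred′ 1≤h)) (sym top≡k+h)))

      g-jPosition : g jPosition ≡ j
      g-jPosition = blockRotation-afterHigh k h j

      jPosition<n : jPosition < n
      jPosition<n = s≤s (subst (j + h <_) (sym top≡k+h) (+-monoˡ-< h j<k))

      j<top : j < top
      j<top = <-trans j<k (<-trans (n<1+n k) k+1<top)

      agree₀ : AgreeBelow (suc (suc j)) f g
      agree₀ {zero} _ = refl
      agree₀ {suc p} (s≤s p<j+1) with m≤n⇒m<n∨m≡n (s≤s⁻¹ p<j+1)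
      ... | inj₁ p<j  = trans (prefix (s≤s p<j)) (trans (skip-< (<-trans p<j j<k)) (sym (blockRotation-low k h j p<j)))
      ... | inj₂ refl = trans fj+1≡k+1 (sym (blockRotation-afterLow k h j 1≤h))

      module AtHigh {d₀ : ℕ} (agree : AgreeBelow (suc (j + suc d₀)) f g) (d₀+1<h : suc d₀ < h) where
        P : ℕ
        P = suc (j + suc d₀)
        b : ℕ
        b = suc (j + d₀)

        b<P : b < P
        b<P = s≤s (+-monoʳ-< j (n<1+n d₀))

        1<b : 1 < b
        1<b = s≤s (≤-trans 1≤j (m≤m+n j d₀))

        fb≡ : f b ≡ suc (k + d₀)
        fb≡ = trans (agree b<P) (blockRotation-high k h j (<-trans (n<1+n d₀) d₀+1<h))

        fb<top : f b < top
        fb<top = subst₂ _<_ (sym fb≡) (sym top≡k+h)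
                   (subst (_≤ k + h) (trans (+-suc k (suc d₀)) (cong suc (+-suc k d₀))) (+-monoʳ-≤ k d₀+1<h))

        j<fb : j < f b
        j<fb = subst (j <_) (sym fb≡) (<-≤-trans j<k (≤-trans (m≤m+n k d₀) (n≤1+n _)))

        P≤topPosition : P ≤ topPosition
        P≤topPosition = s≤s (+-monoʳ-≤ j (pred-mono-≤ d₀+1<h))

        P≤jPosition : P ≤ jPosition
        P≤jPosition = s≤s (+-monoʳ-≤ j (<⇒≤ d₀+1<h))

        -- f P = j + e comes from the tail: with e = 0 it forms 1324 with 0, f b and top,
        -- otherwise it forms 321 with k and j.
        ¬later-rest : ∀ {e} → P < suc (j + h + e) → suc (j + h + e) < n → g (suc (j + h + e)) ≡ f P → P < n → ⊥
        ¬later-rest {e} P<r r<n gr≡fP P<n with e ≟ 0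
        ... | yes refl =
          let rt , P<rt , rt<n , frt≡top = placedAfter G.injective agree P≤topPosition (high<n h-1<h) g-topPosition
                                             (λ top≡fP → contradiction (trans top≡fP fP≡j) (≢-sym (<⇒≢ j<top))) (n<1+n top)
          in avoids1324 1<b b<P P<rt rt<n (subst₂ _<_ (sym f1≡0) (sym fP≡j) 1≤j) (subst (_< f b) (sym fP≡j) j<fb)
                        (subst (f b <_) (sym frt≡top) fb<top)
          where
          fP≡j : f P ≡ j
          fP≡j = trans (sym gr≡fP) (trans (blockRotation-rest k h j 0) (+-identityʳ j))
        ... | no e≢0 =
          let rx , P<rx , rx<n , frx≡j = placedAfter G.injective agree P≤jPosition jPosition<n g-jPosition
                                           (<⇒≢ j<fP) (<-trans j<top (n<1+n top))
          in avoids321 z<s P<rx rx<n (subst (_< k) (sym fP≡j+e) (G.rest<k e r<n)) (subst (_< f P) (sym frx≡j) j<fP)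
          where
          fP≡j+e : f P ≡ j + e
          fP≡j+e = trans (sym gr≡fP) (blockRotation-rest k h j e)
          j<fP : j < f P
          j<fP = subst (j <_) (sym fP≡j+e) (subst (_< j + e) (+-identityʳ j) (+-monoʳ-< j (n≢0⇒n>0 e≢0)))

        -- g P and j both come later; in either order they form a 321 or a 1324.
        ¬later-high-top : ∀ {d} → d < h → P < suc (j + d) → g (suc (j + d)) ≡ f P → P < n → f P ≡ top → ⊥
        ¬later-high-top {d} d<h P<r gr≡fP P<n fP≡top =
          let rs , P<rs , rs<n , frs≡gP = placedAfter G.injective agree ≤-refl P<n refl (<⇒≢ gP<fP) (G.bounded P<n)
              rj , P<rj , rj<n , frj≡j = placedAfter G.injective agree P≤jPosition jPosition<n g-jPosition
                                           (λ j≡fP → <⇒≢ j<top (trans j≡fP fP≡top)) (<-trans j<top (n<1+n top))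
          in order rs rj P<rs P<rj rs<n rj<n frs≡gP frj≡j
          where
          gP≡ : g P ≡ suc (k + suc d₀)
          gP≡ = blockRotation-high k h j d₀+1<h
          gP<fP : g P < f P
          gP<fP = subst₂ _<_ (sym gP≡) (trans (sym (blockRotation-high k h j d<h)) gr≡fP)
                    (s≤s (+-monoʳ-< k (+-cancelˡ-< j (suc d₀) d (s<s⁻¹ P<r))))
          j<gP : j < g P
          j<gP = subst (j <_) (sym gP≡) (<-≤-trans j<k (≤-trans (m≤m+n k (suc d₀)) (n≤1+n _)))
          order : ∀ rs rj → P < rs → P < rj → rs < n → rj < n → f rs ≡ g P → f rj ≡ j → ⊥
          order rs rj P<rs P<rj rs<n rj<n frs≡gP frj≡j with <-cmp rj rs
          ... | tri< rj<rs _ _ =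
            avoids1324 1<b (<-trans b<P P<rj) rj<rs rs<n (subst₂ _<_ (sym f1≡0) (sym frj≡j) 1≤j)
              (subst (_< f b) (sym frj≡j) j<fb)
              (subst₂ _<_ (sym fb≡) (sym frs≡gP) (subst (suc (k + d₀) <_) (sym gP≡) (s≤s (+-monoʳ-< k (n<1+n d₀)))))
          ... | tri≈ _ refl _ = <⇒≢ j<gP (trans (sym frj≡j) frs≡gP)
          ... | tri> _ _ rs<rj =
            avoids321 P<rs rs<rj rj<n (subst (_< f P) (sym frs≡gP) gP<fP) (subst₂ _<_ (sym frj≡j) (sym frs≡gP) j<gP)
        -- The predecessor of f P, a lower value of the same block, and top both come later.
        ¬later-high-belowTop : ∀ {d} → d < h → P < suc (j + d) → g (suc (j + d)) ≡ f P → P < n → f P ≢ top → ⊥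
        ¬later-high-belowTop {d} d<h P<r gr≡fP P<n fP≢top =
          let a , P<a , a<n , fa≡ = placedAfter G.injective agree P≤a₀ (high<n d-1<h) refl
                                      (λ ga₀≡fP → <⇒≢ ga₀<fP ga₀≡fP) (G.bounded (high<n d-1<h))
              t , P<t , t<n , ft≡top = placedAfter G.injective agree P≤topPosition (high<n h-1<h) g-topPosition
                                         (≢-sym fP≢top) (n<1+n top)
          in ¬pred-and-top-after 1<P f1≡0 (≤∧≢⇒< (s≤s⁻¹ (bounded P<n)) fP≢top) P<a a<n
               (trans (cong suc (trans fa≡ ga₀≡)) (trans ga₀+1≡ (sym fP≡))) P<t t<n ft≡top
          where
          fP≡ : f P ≡ suc (k + d)
          fP≡ = trans (sym gr≡fP) (blockRotation-high k h j d<h)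
          d₀+1<d : suc d₀ < d
          d₀+1<d = +-cancelˡ-< j (suc d₀) d (s<s⁻¹ P<r)
          1≤d : 1 ≤ d
          1≤d = ≤-trans (s≤s z≤n) d₀+1<d
          d-1<h : pred d < h
          d-1<h = ≤-<-trans pred[n]≤n d<h
          P≤a₀ : P ≤ suc (j + pred d)
          P≤a₀ = s≤s (+-monoʳ-≤ j (pred-mono-≤ d₀+1<d))
          ga₀≡ : g (suc (j + pred d)) ≡ suc (k + pred d)
          ga₀≡ = blockRotation-high k h j d-1<h
          ga₀+1≡ : suc (suc (k + pred d)) ≡ suc (k + d)
          ga₀+1≡ = cong suc (trans (sym (+-suc k (pred d))) (cong (k +_) (suc-pred′ 1≤d)))
          ga₀<fP : g (suc (j + pred d)) < f P
          ga₀<fP = subst₂ _<_ (sym ga₀≡) (sym fP≡) (subst (suc (k + pred d) <_) ga₀+1≡ ≤-refl)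
          1<P : 1 < P
          1<P = <-trans 1<b b<P

        ¬later-high : ∀ {d} → d < h → P < suc (j + d) → g (suc (j + d)) ≡ f P → P < n → ⊥
        ¬later-high d<h P<r gr≡fP P<n with f P ≟ top
        ... | yes fP≡top = ¬later-high-top d<h P<r gr≡fP P<n fP≡top
        ... | no fP≢top  = ¬later-high-belowTop d<h P<r gr≡fP P<n fP≢top

      ¬later : ∀ {P r} → AgreeBelow P f g → suc (suc j) ≤ P → P < r → r < n → g r ≡ f P → ⊥
      ¬later {P} {r} agree j+2≤P P<r r<n gr≡fP =
        go (blockRotationPosition j h P) (blockRotationPosition j h r) agree j+2≤P P<r r<n gr≡fP
        where
        go : ∀ {P r} → BlockRotationPosition j h P → BlockRotationPosition j h r →
             AgreeBelow P f g → suc (suc j) ≤ P → P < r → r < n → g r ≡ f P → ⊥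
        go first _ _ () _ _ _
        go (low p p<j) _ _ j+2≤P _ _ _ = <-asym p<j (s≤s⁻¹ j+2≤P)
        go (high zero _) _ _ j+2≤P _ _ _ = 1+n≰n (subst (suc j ≤_) (+-identityʳ j) (s≤s⁻¹ j+2≤P))
        go (high (suc d₀) _) first _ _ () _ _
        go (high (suc d₀) _) (low p p<j) _ _ P<r _ _ =
          <-asym p<j (≤-<-trans (m≤m+n j (suc d₀)) (s<s⁻¹ P<r))
        go (high (suc d₀) d₀+1<h) (high d d<h) agree _ P<r r<n gr≡fP =
          AtHigh.¬later-high agree d₀+1<h d<h P<r gr≡fP (<-trans P<r r<n)
        go (high (suc d₀) d₀+1<h) (rest e) agree _ P<r r<n gr≡fP =
          AtHigh.¬later-rest agree d₀+1<h P<r r<n gr≡fP (<-trans P<r r<n)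
        go (rest e) first _ _ () _ _
        go (rest e) (low p p<j) _ _ P<r _ _ =
          <-asym p<j (≤-<-trans (≤-trans (m≤m+n j h) (m≤m+n (j + h) e)) (s<s⁻¹ P<r))
        go (rest e) (high d d<h) _ _ P<r _ _ =
          <-asym (+-monoʳ-< j d<h) (≤-<-trans (m≤m+n (j + h) e) (s<s⁻¹ P<r))
        -- The smaller tail value g P would come after f P, both below k: a 321.
        go {P} (rest e) (rest e′) agree _ P<r r<n gr≡fP =
          let P<n = <-trans P<r r<n
              rx , P<rx , rx<n , frx≡gP = placedAfter G.injective agree ≤-refl P<n refl (<⇒≢ gP<fP) (G.bounded P<n)
          in avoids321 z<s P<rx rx<n (subst (_< k) (trans (sym (blockRotation-rest k h j e′)) gr≡fP) (G.rest<k e′ r<n))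
                       (subst (_< f P) (sym frx≡gP) gP<fP)
          where
          gP<fP : g P < f P
          gP<fP = subst₂ _<_ (sym (blockRotation-rest k h j e)) (trans (sym (blockRotation-rest k h j e′)) gr≡fP)
                    (+-monoʳ-< j (+-cancelˡ-< (j + h) e e′ (s<s⁻¹ P<r)))

    agree : AgreeBelow n f g
    agree = forced G.bounded G.injective agree₀ (s≤s j<top) ¬later

  shape-complete : ∃ λ σ → ValidShape top σ × AgreeBelow n f (shapeFn top σ)
  shape-complete = fromPrefix ascendingPrefix
    where
    fromPrefix : AscendingPrefix → ∃ λ σ → ValidShape top σ × AgreeBelow n f (shapeFn top σ)
    fromPrefix (whole agree) with k <? top
    ... | yes k<top = insertion k (pred top) , (k<top , top-1<top , inj₂ (pred-mono-≤ 2≤top)) , agree′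
      where
      1≤top : 1 ≤ top
      1≤top = ≤-trans (s≤s z≤n) 2≤top
      top-1<top : pred top < top
      top-1<top = subst (pred top <_) (suc-pred′ 1≤top) ≤-refl
      agree′ : AgreeBelow n f (topInsertion top k (pred top))
      agree′ {zero} _ = refl
      agree′ {suc p} p+1<n with topInsertionPosition (pred top) (suc p)
      ... | before p p<top-1 = trans (agree p+1<n) (sym (topInsertion-before top k (pred top) p<top-1))
      ... | topPos = trans (agree p+1<n) (trans (skip-≥ (pred-mono-≤ k<top))
                       (trans (suc-pred′ 1≤top) (sym (topInsertion-top top k (pred top)))))
      ... | after e = contradiction (s≤s⁻¹ p+1<n)
                        (≤⇒≯ (subst (_≤ suc (pred top + e)) (suc-pred′ 1≤top) (s≤s (m≤m+n (pred top) e))))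
    ... | no k≮top = rotation k 0 , inj₁ (k≡top , refl) , agree′
      where
      k≡top : k ≡ top
      k≡top = ≤-antisym (s≤s⁻¹ k<n) (≮⇒≥ k≮top)
      agree′ : AgreeBelow n f (blockRotation k (top ∸ k) 0)
      agree′ {zero} _ = refl
      agree′ {suc p} p+1<n = trans (agree p+1<n) (trans (skip-< (subst (p <_) (sym k≡top) (s≤s⁻¹ p+1<n)))
        (sym (subst (λ h → blockRotation k h 0 (suc p) ≡ p) (sym (trans (cong (top ∸_) k≡top) (n∸n≡0 top)))
                    (blockRotation-rest k 0 0 p))))
    fromPrefix (topAfter q prefix fq+1≡top skip<top k≡0⊎1≤q) =
      insertion k q , (T.k<top , T.q<top , k≡0⊎1≤q) , T.agree
      where module T = AfterTop q prefix fq+1≡top skip<top k≡0⊎1≤q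
    fromPrefix (blockAfter j prefix fj+1≡k+1 1≤j j<k k+1<top) =
      rotation k j , inj₂ (1≤j , j<k , k+1<top) , B.agree
      where module B = AfterBlock j prefix fj+1≡k+1 1≤j j<k k+1<top

-- Enumeration and count

concatMap-unique : ∀ {A B : Set} {F : A → List B} {xs} → Unique xs → (∀ x → Unique (F x)) →
                   (∀ {x y z} → z ∈ F x → z ∈ F y → x ≡ y) → Unique (concatMap F xs)
concatMap-unique {xs = []} _ _ _ = []
concatMap-unique {F = F} {xs = x ∷ xs} (x∉xs ∷ xs-unique) F-unique owner =
  Unique.++⁺ (F-unique x) (concatMap-unique xs-unique F-unique owner) disjoint
  where
  disjoint : ∀ {z} → ¬ (z ∈ F x × z ∈ concatMap F xs)
  disjoint (z∈Fx , z∈rest) =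
    let y , y∈xs , z∈Fy = find (∈-concatMap⁻ F z∈rest) in All.lookup x∉xs y∈xs (owner z∈Fx z∈Fy)

applyDownFrom-unique : ∀ {A : Set} {f : ℕ → A} → (∀ {i j} → f i ≡ f j → i ≡ j) → ∀ m → Unique (applyDownFrom f m)
applyDownFrom-unique f-injective m = Unique.applyDownFrom⁺₁ _ m λ j<i _ eq → <⇒≢ j<i (sym (f-injective eq))

insertionsWithFirst : ℕ → ℕ → List Shape
insertionsWithFirst top k = applyDownFrom (insertion k ∘ suc) (pred top)

positiveFirsts : ℕ → List ℕ
positiveFirsts top = applyDownFrom suc (pred top)

insertions : ℕ → List Shape
insertions top = applyDownFrom (insertion 0) top ++ concatMap (insertionsWithFirst top) (positiveFirsts top)

rotationsWithFirst : ℕ → List Shape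
rotationsWithFirst k = applyDownFrom (rotation k ∘ suc) (pred k)

middleFirsts : ℕ → List ℕ
middleFirsts top = applyDownFrom (2 +_) (top ∸ 3)

rotations : ℕ → List Shape
rotations top = rotation top 0 ∷ concatMap rotationsWithFirst (middleFirsts top)

shapes : ℕ → List Shape
shapes top = insertions top ++ rotations top

<pred⇒suc< : ∀ {i m} → i < pred m → suc i < m
<pred⇒suc< {m = suc _} i<m-1 = s<s i<m-1

∈-insertions⁻ : ∀ {top σ} → σ ∈ insertions top → ValidShape top σ
∈-insertions⁻ {top} σ∈ with ∈-++⁻ (applyDownFrom (insertion 0) top) σ∈
... | inj₁ σ∈first with q , q<top , refl ← ∈-applyDownFrom⁻ (insertion 0) σ∈first =
  ≤-<-trans z≤n q<top , q<top , inj₁ refl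
... | inj₂ σ∈rest
  with k , k∈ , σ∈k ← find (∈-concatMap⁻ (insertionsWithFirst top) {positiveFirsts top} σ∈rest)
  with i , i<top-1 , refl ← ∈-applyDownFrom⁻ suc k∈
  with i′ , i′<top-1 , refl ← ∈-applyDownFrom⁻ (insertion (suc i) ∘ suc) σ∈k =
  <pred⇒suc< i<top-1 , <pred⇒suc< i′<top-1 , inj₂ (s≤s z≤n)

∈-insertions⁺ : ∀ {top k q} → k < top → q < top → k ≡ 0 ⊎ 1 ≤ q → insertion k q ∈ insertions top
∈-insertions⁺ {top} {zero} _ q<top _ = ∈-++⁺ˡ (∈-applyDownFrom⁺ (insertion 0) q<top)
∈-insertions⁺ {top} {suc k} {suc q} k<top q<top _ =
  ∈-++⁺ʳ (applyDownFrom (insertion 0) top)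
    (∈-concatMap⁺ (insertionsWithFirst top) {positiveFirsts top}
      (lose (∈-applyDownFrom⁺ suc (pred-mono-< k<top)) (∈-applyDownFrom⁺ (insertion (suc k) ∘ suc) (pred-mono-< q<top))))
∈-insertions⁺ {top} {suc k} {zero} _ _ (inj₁ ())
∈-insertions⁺ {top} {suc k} {zero} _ _ (inj₂ ())

∈-rotations⁻ : ∀ {top σ} → σ ∈ rotations top → ValidShape top σ
∈-rotations⁻ (here refl) = inj₁ (refl , refl)
∈-rotations⁻ {top} (there σ∈)
  with k , k∈ , σ∈k ← find (∈-concatMap⁻ rotationsWithFirst {middleFirsts top} σ∈)
  with i , i<top-3 , refl ← ∈-applyDownFrom⁻ (2 +_) k∈
  with j , j<i+1 , refl ← ∈-applyDownFrom⁻ (rotation (2 + i) ∘ suc) σ∈k =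
  inj₂ (s≤s z≤n , s≤s j<i+1 ,
        subst (_≤ top) (+-comm (suc i) 3) (m≤o∸n⇒m+n≤o (suc i) (<⇒≤ (m∸n≢0⇒n<m (m<n⇒n≢0 i<top-3))) i<top-3))

∈-rotations⁺ : ∀ {top k j} → ValidShape top (rotation k j) → rotation k j ∈ rotations top
∈-rotations⁺ (inj₁ (refl , refl)) = here refl
∈-rotations⁺ {top} {suc (suc i)} {suc j} (inj₂ (_ , j<k , 2+k≤top)) =
  there (∈-concatMap⁺ rotationsWithFirst {middleFirsts top}
    (lose (∈-applyDownFrom⁺ (2 +_) (m+n≤o⇒m≤o∸n (suc i) (subst (_≤ top) (+-comm 3 (suc i)) 2+k≤top)))
          (∈-applyDownFrom⁺ (rotation (2 + i) ∘ suc) (s<s⁻¹ j<k))))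
∈-rotations⁺ {k = zero} (inj₂ (_ , () , _))
∈-rotations⁺ {k = suc zero} {suc _} (inj₂ (_ , s≤s () , _))

rotation∉insertions : ∀ {top k j} → ¬ rotation k j ∈ insertions top
rotation∉insertions {top} ρ∈ with ∈-++⁻ (applyDownFrom (insertion 0) top) ρ∈
... | inj₁ ρ∈first with _ , _ , () ← ∈-applyDownFrom⁻ (insertion 0) ρ∈first
... | inj₂ ρ∈rest with k , _ , ρ∈k ← find (∈-concatMap⁻ (insertionsWithFirst top) {positiveFirsts top} ρ∈rest)
                  with _ , _ , () ← ∈-applyDownFrom⁻ (insertion k ∘ suc) ρ∈k

insertion∉rotations : ∀ {top k q} → ¬ insertion k q ∈ rotations top
insertion∉rotations {top} (there ι∈) with k , _ , ι∈k ← find (∈-concatMap⁻ rotationsWithFirst {middleFirsts top} ι∈)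
                               with _ , _ , () ← ∈-applyDownFrom⁻ (rotation k ∘ suc) ι∈k

∈-shapes⇔ : ∀ {top σ} → σ ∈ shapes top ⇔ ValidShape top σ
∈-shapes⇔ {top} {σ} = mk⇔ (λ σ∈ → [ ∈-insertions⁻ , ∈-rotations⁻ ]′ (∈-++⁻ (insertions top) σ∈)) (valid⇒∈ σ)
  where
  valid⇒∈ : ∀ σ → ValidShape top σ → σ ∈ shapes top
  valid⇒∈ (insertion k q) (k<top , q<top , k≡0⊎1≤q) = ∈-++⁺ˡ (∈-insertions⁺ k<top q<top k≡0⊎1≤q)
  valid⇒∈ (rotation k j) valid = ∈-++⁺ʳ (insertions top) (∈-rotations⁺ valid)

private
  insertion-injective : ∀ {k k′ q q′} → insertion k q ≡ insertion k′ q′ → k ≡ k′ × q ≡ q′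
  insertion-injective refl = refl , refl

  rotation-injective : ∀ {k k′ j j′} → rotation k j ≡ rotation k′ j′ → k ≡ k′ × j ≡ j′
  rotation-injective refl = refl , refl

insertions-unique : ∀ top → Unique (insertions top)
insertions-unique top = Unique.++⁺ (applyDownFrom-unique (proj₂ ∘ insertion-injective) top)
  (concatMap-unique (applyDownFrom-unique suc-injective (pred top))
    (λ k → applyDownFrom-unique (suc-injective ∘ proj₂ ∘ insertion-injective) (pred top)) owner)
  disjoint
  where
  owner : ∀ {k k′ σ} → σ ∈ insertionsWithFirst top k → σ ∈ insertionsWithFirst top k′ → k ≡ k′
  owner {k} {k′} σ∈k σ∈k′
    with _ , _ , refl ← ∈-applyDownFrom⁻ (insertion k ∘ suc) σ∈k
    with _ , _ , eq ← ∈-applyDownFrom⁻ (insertion k′ ∘ suc) σ∈k′ = proj₁ (insertion-injective eq)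
  disjoint : ∀ {σ} → ¬ (σ ∈ applyDownFrom (insertion 0) top × σ ∈ concatMap (insertionsWithFirst top) (positiveFirsts top))
  disjoint (σ∈first , σ∈rest)
    with _ , _ , refl ← ∈-applyDownFrom⁻ (insertion 0) σ∈first
    with k , k∈ , σ∈k ← find (∈-concatMap⁻ (insertionsWithFirst top) {positiveFirsts top} σ∈rest)
    with _ , _ , refl ← ∈-applyDownFrom⁻ suc k∈
    with _ , _ , ()   ← ∈-applyDownFrom⁻ (insertion k ∘ suc) σ∈k

rotations-unique : ∀ top → Unique (rotations top)
rotations-unique top =
  All.tabulate first-fresh ∷
  concatMap-unique (applyDownFrom-unique (+-cancelˡ-≡ 2 _ _) (top ∸ 3))
    (λ k → applyDownFrom-unique (suc-injective ∘ proj₂ ∘ rotation-injective) (pred k)) owner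
  where
  first-fresh : ∀ {σ} → σ ∈ concatMap rotationsWithFirst (middleFirsts top) → rotation top 0 ≢ σ
  first-fresh σ∈ with k , _ , σ∈k ← find (∈-concatMap⁻ rotationsWithFirst {middleFirsts top} σ∈)
                 with _ , _ , refl ← ∈-applyDownFrom⁻ (rotation k ∘ suc) σ∈k = λ ()
  owner : ∀ {k k′ σ} → σ ∈ rotationsWithFirst k → σ ∈ rotationsWithFirst k′ → k ≡ k′
  owner {k} {k′} σ∈k σ∈k′
    with _ , _ , refl ← ∈-applyDownFrom⁻ (rotation k ∘ suc) σ∈k
    with _ , _ , eq ← ∈-applyDownFrom⁻ (rotation k′ ∘ suc) σ∈k′ = proj₁ (rotation-injective eq)

shapes-unique : ∀ top → Unique (shapes top)
shapes-unique top = Unique.++⁺ (insertions-unique top) (rotations-unique top) disjoint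
  where
  disjoint : ∀ {σ} → ¬ (σ ∈ insertions top × σ ∈ rotations top)
  disjoint {insertion _ _} (_ , ι∈) = insertion∉rotations {top} ι∈
  disjoint {rotation _ _}  (ρ∈ , _) = rotation∉insertions {top} ρ∈

length-insertions : ∀ top → length (insertions top) ≡ top + pred top * pred top
length-insertions top = trans (length-++ (applyDownFrom (insertion 0) top))
  (cong₂ _+_ (length-applyDownFrom (insertion 0) top) (length-after (pred top)))
  where
  length-after : ∀ r → length (concatMap (insertionsWithFirst top) (applyDownFrom suc r)) ≡ r * pred top
  length-after zero    = refl
  length-after (suc r) = trans (length-++ (insertionsWithFirst top (suc r)))
    (cong₂ _+_ (length-applyDownFrom (insertion (suc r) ∘ suc) (pred top)) (length-after r))

length-rotations : ∀ top → 2 * length (rotations top) ≡ 2 + (top ∸ 3) * suc (top ∸ 3)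
length-rotations top = trans (*-suc 2 _) (cong (2 +_) (length-middle (top ∸ 3)))
  where
  length-middle : ∀ r → 2 * length (concatMap rotationsWithFirst (applyDownFrom (2 +_) r)) ≡ r * suc r
  length-middle zero    = refl
  length-middle (suc r) = begin
    2 * length (rotationsWithFirst (2 + r) ++ others)  ≡⟨ cong (2 *_) (length-++ (rotationsWithFirst (2 + r))) ⟩
    2 * (length (rotationsWithFirst (2 + r)) + length others)
      ≡⟨ cong (λ l → 2 * (l + length others)) (length-applyDownFrom (rotation (2 + r) ∘ suc) (suc r)) ⟩
    2 * (suc r + length others)                        ≡⟨ *-distribˡ-+ 2 (suc r) (length others) ⟩
    2 * suc r + 2 * length others                      ≡⟨ cong (2 * suc r +_) (length-middle r) ⟩
    2 * suc r + r * suc r                            ≡⟨ *-distribʳ-+ (suc r) 2 r ⟨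
    (2 + r) * suc r                                  ≡⟨ *-comm (2 + r) (suc r) ⟩
    suc r * suc (suc r)                              ∎
    where
    open ≡-Reasoning
    others : List Shape
    others = concatMap rotationsWithFirst (applyDownFrom (2 +_) r)

insertion≁rotation : ∀ {top k q j} → ValidShape top (insertion k q) → ValidShape top (rotation k j) →
                     ¬ AgreeBelow (suc top) (topInsertion top k q) (blockRotation k (top ∸ k) j)
insertion≁rotation (k<top , _) (inj₁ (k≡top , _)) _ = <⇒≢ k<top k≡top
insertion≁rotation {top} {k} {q} {j} (k<top , q<top , k≡0⊎1≤q) (inj₂ (1≤j , j<k , 2+k≤top)) agree =
  ruledOut (TopInsertion.ascent⊎descent top k q k<top q<top k≡0⊎1≤q a<b b<n)
  where
  h : ℕ
  h = top ∸ k
  g : ℕ → ℕ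
  g = topInsertion top k q
  top≡k+h : top ≡ k + h
  top≡k+h = sym (m+[n∸m]≡n (<⇒≤ k<top))
  a<b : suc j < suc (j + h)
  a<b = s≤s (m<m+n j (m<n⇒0<n∸m k<top))
  b<n : suc (j + h) < suc top
  b<n = s≤s (subst (j + h <_) (sym top≡k+h) (+-monoˡ-< h j<k))
  ga≡k+1 : g (suc j) ≡ suc k
  ga≡k+1 = trans (agree (<-trans a<b b<n)) (blockRotation-afterLow k h j (m<n⇒0<n∸m k<top))
  gb≡j : g (suc (j + h)) ≡ j
  gb≡j = trans (agree b<n) (blockRotation-afterHigh k h j)
  -- The rotation puts suc k before j; the insertion only descends from position 0 or from top.
  ruledOut : g (suc j) < g (suc (j + h)) ⊎ (g (suc (j + h)) < g (suc j) × (suc j ≡ 0 ⊎ g (suc j) ≡ top)) → ⊥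
  ruledOut (inj₁ ga<gb) = <-asym j<k (<-trans (n<1+n k) (subst₂ _<_ ga≡k+1 gb≡j ga<gb))
  ruledOut (inj₂ (_ , inj₁ ()))
  ruledOut (inj₂ (_ , inj₂ ga≡top)) = <⇒≢ 2+k≤top (trans (sym ga≡k+1) ga≡top)

shape-injective : ∀ {top} σ τ → ValidShape top σ → ValidShape top τ →
                  AgreeBelow (suc top) (shapeFn top σ) (shapeFn top τ) → σ ≡ τ
shape-injective {top} (insertion k q) (insertion k′ q′) (k<top , q<top , k≡0⊎1≤q) (_ , q′<top , _) agree
  with refl ← agree {0} z<s =
  cong (insertion k) (suc-injective (TopInsertion.injective top k q k<top q<top k≡0⊎1≤q (s≤s q<top) (s≤s q′<top)
    (trans (topInsertion-top top k q) (sym (trans (agree (s≤s q′<top)) (topInsertion-top top k q′))))))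
shape-injective (insertion k q) (rotation k′ j) ι ρ agree with refl ← agree {0} z<s =
  ⊥-elim (insertion≁rotation ι ρ agree)
shape-injective (rotation k j) (insertion k′ q) ρ ι agree with refl ← agree {0} z<s =
  ⊥-elim (insertion≁rotation ι ρ (λ p<n → sym (agree p<n)))
shape-injective {top} (rotation k j) (rotation k′ j′) ρ ρ′ agree with refl ← agree {0} z<s =
  cong (rotation k) (same-j ρ ρ′)
  where
  ¬top : k ≡ top → ¬ 2 + k ≤ top
  ¬top k≡top 2+k≤top = 1+n≰n (≤-trans (n≤1+n _) (subst (λ x → 2 + x ≤ top) k≡top 2+k≤top))
  same-j : ValidShape top (rotation k j) → ValidShape top (rotation k j′) → j ≡ j′
  same-j (inj₁ (_ , j≡0)) (inj₁ (_ , j′≡0)) = trans j≡0 (sym j′≡0)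
  same-j (inj₁ (k≡top , _)) (inj₂ (_ , _ , 2+k≤top)) = contradiction 2+k≤top (¬top k≡top)
  same-j (inj₂ (_ , _ , 2+k≤top)) (inj₁ (k≡top , _)) = contradiction 2+k≤top (¬top k≡top)
  same-j (inj₂ (1≤j , j<k , 2+k≤top)) (inj₂ (_ , j′<k , _)) =
    suc-injective (BlockRotation.injective top k h j top≡k+h (<⇒≤ j<k) (inj₁ 1≤j) (j+1<n j<k) (j+1<n j′<k)
      (trans (blockRotation-afterLow k h j 1≤h) (sym (trans (agree (j+1<n j′<k)) (blockRotation-afterLow k h j′ 1≤h)))))
    where
    h : ℕ
    h = top ∸ k
    k<top : k < top
    k<top = ≤-trans (n≤1+n _) 2+k≤top
    top≡k+h : top ≡ k + h
    top≡k+h = sym (m+[n∸m]≡n (<⇒≤ k<top))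
    1≤h : 1 ≤ h
    1≤h = m<n⇒0<n∸m k<top
    j+1<n : ∀ {i} → i < k → suc i < suc top
    j+1<n i<k = s≤s (<-trans i<k k<top)

unique-map : ∀ {A B : Set} (w : A → B) {xs} → Unique xs →
             (∀ {a b} → a ∈ xs → b ∈ xs → w a ≡ w b → a ≡ b) → Unique (map w xs)
unique-map w {[]} _ _ = []
unique-map w {x ∷ xs} (x∉xs ∷ xs-unique) w-injective =
  All.map⁺ (All.tabulate λ y∈xs wx≡wy → All.lookup x∉xs y∈xs (w-injective (here refl) (there y∈xs) wx≡wy)) ∷
  unique-map w xs-unique (λ a∈ b∈ → w-injective (there a∈) (there b∈))

numberOf-image : ∀ {A : Set} {n} {P : Word n → Set} (w : A → Word n) (xs : List A) → Unique xs →
                 (∀ {a b} → a ∈ xs → b ∈ xs → w a ≡ w b → a ≡ b) → (∀ {a} → a ∈ xs → P (w a)) →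
                 (∀ π → P π → ∃ λ a → a ∈ xs × π ≡ w a) → NumberOf n P (length xs)
numberOf-image {P = P} w xs xs-unique w-injective sound complete =
  map w xs , unique-map w xs-unique w-injective , (λ π → mk⇔ (image⇒P π) (P⇒image π)) , length-map w xs
  where
  image⇒P : ∀ π → π ∈ map w xs → P π
  image⇒P π π∈ = let a , a∈ , π≡wa = ∈-map⁻ w π∈ in subst P (sym π≡wa) (sound a∈)
  P⇒image : ∀ π → P π → π ∈ map w xs
  P⇒image π Pπ = let a , a∈ , π≡wa = complete π Pπ in subst (_∈ map w xs) (sym π≡wa) (∈-map⁺ w a∈)

shapes-count : ∀ top → 2 ≤ top → NumberOf (suc top) FishburnAvoiding321-1324 (length (shapes top))
shapes-count top 2≤top =
  numberOf-image (wordOf ∘ shapeFn top) (shapes top) (shapes-unique top) injective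
    (λ {σ} σ∈ → avoider⇒word (shape-avoider σ (valid σ∈))) complete
  where
  valid : ∀ {σ} → σ ∈ shapes top → ValidShape top σ
  valid = Equivalence.to ∈-shapes⇔
  bounded : ∀ {σ} → σ ∈ shapes top → Bounded (suc top) (shapeFn top σ)
  bounded {σ} σ∈ = FishburnAvoider.bounded (shape-avoider σ (valid σ∈))
  injective : ∀ {σ τ} → σ ∈ shapes top → τ ∈ shapes top → wordOf (shapeFn top σ) ≡ wordOf (shapeFn top τ) → σ ≡ τ
  injective {σ} {τ} σ∈ τ∈ eq = shape-injective σ τ (valid σ∈) (valid τ∈) λ {p} p<n →
    trans (sym (at-wordOf (bounded σ∈) p<n)) (trans (cong (λ π → at π p) eq) (at-wordOf (bounded τ∈) p<n))
  complete : ∀ π → FishburnAvoiding321-1324 π → ∃ λ σ → σ ∈ shapes top × π ≡ wordOf (shapeFn top σ)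
  complete π π-avoids =
    let σ , σ-valid , agree = Classification.shape-complete 2≤top (word⇒avoider {π = π} π-avoids)
    in σ , Equivalence.from ∈-shapes⇔ σ-valid , ≡wordOf π agree

count-formula : ∀ m → 2 * length (shapes (2 + m)) + 13 * (3 + m) ≡ 3 * ((3 + m) * (3 + m)) + 20
count-formula m = begin
  2 * length (insertions top ++ rotations top) + 13 * (3 + m)
    ≡⟨ cong (λ l → 2 * l + 13 * (3 + m)) (length-++ (insertions top)) ⟩
  2 * (length (insertions top) + length (rotations top)) + 13 * (3 + m)
    ≡⟨ cong (_+ 13 * (3 + m)) (*-distribˡ-+ 2 (length (insertions top)) _) ⟩
  2 * length (insertions top) + 2 * length (rotations top) + 13 * (3 + m)
    ≡⟨ cong₂ (λ i r → 2 * i + r + 13 * (3 + m)) (length-insertions top) (length-rotations top) ⟩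
  2 * (2 + m + suc m * suc m) + (2 + (m ∸ 1) * suc (m ∸ 1)) + 13 * (3 + m)
    ≡⟨ polynomial m ⟩
  3 * ((3 + m) * (3 + m)) + 20 ∎
  where
  open ≡-Reasoning
  top : ℕ
  top = 2 + m
  polynomial : ∀ m → 2 * (2 + m + suc m * suc m) + (2 + (m ∸ 1) * suc (m ∸ 1)) + 13 * (3 + m) ≡ 3 * ((3 + m) * (3 + m)) + 20
  polynomial zero    = refl
  polynomial (suc m) = solved m
    where
    solved : ∀ m → 2 * (3 + m + (2 + m) * (2 + m)) + (2 + m * suc m) + 13 * (4 + m) ≡ 3 * ((4 + m) * (4 + m)) + 20
    solved = solve-∀

theorem2p6 : ∀ (n : ℕ) → 3 ≤ n →
    Σ ℕ λ c → NumberOf n FishburnAvoiding321-1324 c × (2 * c + 13 * n ≡ 3 * (n * n) + 20)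
theorem2p6 (suc (suc (suc m))) (s≤s (s≤s (s≤s _))) =
  length (shapes (2 + m)) , shapes-count (2 + m) (s≤s (s≤s z≤n)) , count-formula m
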